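{- Let $q>2$ be a prime power, let $M$ be a simple $GF(q)$-representable matroid and $e\in E(M)$, and suppose $\mathrm{si}(M/e)\cong U_{r,n}$ for some $r,n$ with $2<r<n$. Then $M$ has an induced restriction isomorphic to a member of $\{U_{2+t,k+t}:3\leq k\leq q\text{ and }0\leq t\leq q-3\}\cup\{U_{r,n},U_{r+1,n+1}\}$.
   Context: An induced restriction of a matroid $N$ is $N|F$ for a flat $F$ of $N$. -}

module Defs where

open import Level using (0ℓ) renaming (suc to lsuc)
open import Data.Nat using (ℕ; zero; suc; _≤_; _<_; _^_)
open import Data.Nat.Primality using (Prime)
open import Data.Fin using (Fin)
import Data.Fin as Fin
open import Data.Empty using (⊥)
open import Data.Fin.Subset using (Subset; _∈_; _∉_; _⊆_; ⁅_⁆; _∪_; ∣_∣; ∁) renaming (⊥ to ∅)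
open import Data.Vec using (tabulate; lookup)
open import Data.Product using (Σ; ∃; _×_; _,_)
open import Data.Sum using (_⊎_)
open import Relation.Nullary using (¬_)
open import Relation.Binary.PropositionalEquality using (_≡_; _≢_)
open import Function.Definitions using (Injective)
open import Function.Bundles using (_⇔_)
open import Algebra.Bundles using (CommutativeRing)

record Matroid (m : ℕ) : Set₁ where
  field
    Indep     : Subset m → Set
    indep-∅   : Indep ∅
    indep-⊆   : ∀ {X Y} → Y ⊆ X → Indep X → Indep Y
    indep-aug : ∀ {X Y} → Indep X → Indep Y → ∣ X ∣ < ∣ Y ∣ →
                ∃ λ e → e ∈ Y × e ∉ X × Indep (X ∪ ⁅ e ⁆)
open Matroid public

Loop : ∀ {m} → (Subset m → Set) → Fin m → Set
Loop I x = ¬ I ⁅ x ⁆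

Parallel : ∀ {m} → (Subset m → Set) → Fin m → Fin m → Set
Parallel I x y = x ≢ y × I ⁅ x ⁆ × I ⁅ y ⁆ × ¬ I (⁅ x ⁆ ∪ ⁅ y ⁆)

Simple : ∀ {m} → Matroid m → Set
Simple M = (∀ x → ¬ Loop (Indep M) x) × (∀ x y → ¬ Parallel (Indep M) x y)

IsRank : ∀ {m} → (Subset m → Set) → Subset m → ℕ → Set
IsRank I X r = (∃ λ J → J ⊆ X × I J × ∣ J ∣ ≡ r)
             × (∀ J → J ⊆ X → I J → ∣ J ∣ ≤ r)

-- F is a flat of M (M has ground set all of Fin m): adding any element
-- outside F increases the rank.
IsFlat : ∀ {m} → Matroid m → Subset m → Set
IsFlat M F = ∀ x → x ∉ F → ∀ r →
             IsRank (Indep M) F r → IsRank (Indep M) (F ∪ ⁅ x ⁆) r → ⊥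

-- contraction M/e: ground set E - e; X independent in M/e iff e ∉ X and
-- X ∪ B is independent in M for a basis B of {e}
-- (B = {e} if e is not a loop, B = ∅ if e is a loop).
ContractIndep : ∀ {m} → Matroid m → Fin m → Subset m → Set
ContractIndep M e X = e ∉ X
                    × (Indep M ⁅ e ⁆ → Indep M (X ∪ ⁅ e ⁆))
                    × (¬ Indep M ⁅ e ⁆ → Indep M X)

preimage : ∀ {n m} → (Fin n → Fin m) → Subset m → Subset n
preimage f X = tabulate (λ y → lookup X (f y))

-- The restriction of the set system (Fin m, I) to S is isomorphic to the
-- set system (Fin n, J): a bijection f : Fin n → S preserving independence.
IsoRestr : ∀ {m n} → (Subset m → Set) → Subset m → (Subset n → Set) → Set
IsoRestr {m} {n} I S J =
  Σ (Fin n → Fin m) λ f →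
      Injective _≡_ _≡_ f
    × (∀ y → f y ∈ S)
    × (∀ x → x ∈ S → ∃ λ y → f y ≡ x)
    × (∀ X → X ⊆ S → (I X ⇔ J (preimage f X)))

-- si(N) ≅ U for N = (ground set G, independence I): si(N) is obtained by
-- deleting all loops and all but one element of each parallel class,
-- i.e. it is N|S for a set S of representatives.
SiIso : ∀ {m n} → (Subset m → Set) → Subset m → (Subset n → Set) → Set
SiIso I G J = Σ _ λ S →
    S ⊆ G
  × (∀ x → x ∈ S → ¬ Loop I x)
  × (∀ x y → x ∈ S → y ∈ S → ¬ Parallel I x y)
  × (∀ x → x ∈ G → ¬ Loop I x → x ∈ S ⊎ (∃ λ y → y ∈ S × Parallel I x y))
  × IsoRestr I S J

UIndep : (r n : ℕ) → Subset n → Set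
UIndep r n Y = ∣ Y ∣ ≤ r

IsField : CommutativeRing 0ℓ 0ℓ → Set
IsField R = ¬ (0# ≈ 1#) × (∀ x → ¬ (x ≈ 0#) → ∃ λ y → x * y ≈ 1#)
  where open CommutativeRing R

HasSize : CommutativeRing 0ℓ 0ℓ → ℕ → Set
HasSize R q = Σ (Fin q → Carrier) λ g →
    (∀ i j → g i ≈ g j → i ≡ j) × (∀ x → ∃ λ i → g i ≈ x)
  where open CommutativeRing R

sumF : ∀ {A : Set} (_+_ : A → A → A) (z : A) {n} → (Fin n → A) → A
sumF _+_ z {zero}  f = z
sumF _+_ z {suc n} f = f Fin.zero + sumF _+_ z (λ i → f (Fin.suc i))

RepresentedBy : ∀ {m} (R : CommutativeRing 0ℓ 0ℓ) (d : ℕ) →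
                Matroid m → (Fin m → Fin d → CommutativeRing.Carrier R) → Set
RepresentedBy {m} R d M v = ∀ X → Indep M X ⇔ LinIndep X
  where
  open CommutativeRing R
  LinIndep : Subset m → Set
  LinIndep X = ∀ (c : Fin m → Carrier) → (∀ x → x ∉ X → c x ≈ 0#) →
               (∀ j → sumF _+_ 0# (λ x → c x * v x j) ≈ 0#) →
               ∀ x → c x ≈ 0#

GFRepresentable : ∀ {m} → ℕ → Matroid m → Set₁
GFRepresentable {m} q M = Σ (CommutativeRing 0ℓ 0ℓ) λ R →
  IsField R × HasSize R q ×
  (∃ λ d → Σ (Fin m → Fin d → CommutativeRing.Carrier R) λ v → RepresentedBy R d M v)

IsPrimePower : ℕ → Set
IsPrimePower q = ∃ λ p → ∃ λ k → Prime p × q ≡ p ^ suc k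

-- Let S be a set of representatives of the parallel classes of M / e, so that for X ⊆ S the set
-- X ∪ {e} is independent exactly when |X| ≤ r.  Call T ∌ e a transversal if no two of its elements
-- are parallel in M / e.  Replacing the elements of a transversal one at a time by their
-- representatives shows that T ∪ {e} is independent iff |T| ≤ r; in particular M has rank r + 1.
--
-- If some transversal T with r + 1 elements is dependent, the closure F of r of its elements is a
-- flat of rank r avoiding e which is itself a transversal, so M|F ≅ U_{r,|F|} with r < |F| ≤ n.
-- If |F| < n, representability of the minor U_{r,n} gives n ≤ q + r - 1 (a line of PG(r-1, q) has
-- at most q + 1 points) and r ≤ q - 1 (r + 2 points in general position in rank r need distinct
-- non-zero cross ratios), which puts U_{r,|F|} into the family U_{2+t,k+t}.
--
-- Otherwise every transversal with r + 1 elements is independent.  If the line spanned by e and a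
-- point s ∈ S has a third point, it is a flat U_{2,k}; contracting r - 1 further points of S turns
-- it, together with one more point of S, into a line with k + 1 points, so k ≤ q.  If no such line
-- exists, every element other than e lies in S and M itself is U_{r+1,n+1}.

module Submission where

open import Level using (0ℓ)
open import Algebra.Bundles using (CommutativeRing)
import Algebra.Properties.CommutativeSemigroup as CommutativeSemigroupProperties
import Algebra.Properties.Ring as RingProperties
open import Data.Bool using (true)
open import Data.Empty using (⊥-elim)
open import Data.Fin using (Fin; zero; suc; punchOut)
open import Data.Fin.Properties
  using (any?; all?; injective⇒≤; suc-injective; punchOut-injective; ¬Fin0; 0≢1+n)
  renaming (_≟_ to _≟ᶠ_)
open import Data.Fin.Subset
  using (Subset; _∈_; _∉_; _⊆_; _∪_; _─_; _-_; ⁅_⁆; ∣_∣; ∁; ⊤; Nonempty; outside; inside)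
  renaming (⊥ to ∅)
open import Data.Fin.Subset.Properties
  using (_∈?_; x∈⁅x⁆; x∈⁅y⁆⇒x≡y; x≢y⇒x∉⁅y⁆; x∈p∪q⁻; p⊆p∪q; q⊆p∪q; x∈p∧x≢y⇒x∈p-y;
         x∈p∧x∉q⇒x∈p─q; x∈p⇒∣p-x∣<∣p∣; p⊆q⇒∣p∣≤∣q∣; ⊆-refl; drop-∷-⊆; ∪-identityˡ; ∪-comm; p─⊥≡p; ⊥⊆;
         ∣⊥∣≡0; ∣⁅x⁆∣≡1; ∣p∣≤n; ∣⊤∣≡n; ∈⊤; x∉p⇒x∈∁p; x∈∁p⇒x∉p; anySubset?)
open import Data.Nat using (ℕ; zero; suc; pred; _+_; _∸_; _≤_; _<_; z≤n; s≤s; _≤?_; _≟_)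
open import Data.Nat.Properties as ℕₚ
  using (≤-refl; ≤-reflexive; ≤-trans; ≤-antisym; ≤-pred; <-irrefl; <-trans; <-≤-trans; ≤-<-trans; <⇒≤;
         ≰⇒>; ≤∧≢⇒<; m≤n⇒m<n∨m≡n; n≤1+n; m≤m+n; m≤n+m; +-suc;
         +-monoˡ-≤; +-cancelʳ-≤; m∸n≤m; m∸n+n≡m; m+[n∸m]≡n; m+n∸m≡n; ∸-monoˡ-≤; m≤n⇒∃[o]m+o≡n;
         module ≤-Reasoning)
open import Data.Product using (Σ; Σ-syntax; ∃; _×_; _,_; proj₁; proj₂)
open import Data.Sum using (_⊎_; inj₁; inj₂; [_,_]′)
open import Data.Vec using (Vec; []; _∷_; tabulate; lookup)
open import Data.Vec.Base using (here; there)
open import Data.Vec.Properties using (lookup∘tabulate; []=⇒lookup; lookup⇒[]=)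
open import Function using (_∘_; case_of_)
open import Function.Bundles using (_⇔_; mk⇔; Equivalence)
open import Function.Definitions using (Injective)
import Function.Properties.Equivalence as ⇔
open import Relation.Binary.PropositionalEquality
  using (_≡_; _≢_; refl; sym; trans; cong; subst; subst₂; module ≡-Reasoning)
import Relation.Binary.Reasoning.Setoid as SetoidReasoning
open import Relation.Nullary using (¬_; Dec; yes; no; does; contradiction)
open import Relation.Nullary.Decidable using (map′; ¬?; _×-dec_; _⊎-dec_; _→-dec_; decidable-stable)
open import Relation.Unary using (Decidable; Pred)

open import Defs

private variable
  k m n : ℕ
  p q s : Subset n
  x y : Fin n

-- Finite subsets

x∈⁅x⁆∪p : x ∈ ⁅ x ⁆ ∪ p
x∈⁅x⁆∪p {x = zero}  {p = _ ∷ _} = here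
x∈⁅x⁆∪p {x = suc x} {p = _ ∷ _} = there x∈⁅x⁆∪p

p⊆⁅x⁆∪p : p ⊆ ⁅ x ⁆ ∪ p
p⊆⁅x⁆∪p {p = p} {x = x} = q⊆p∪q ⁅ x ⁆ p

∈-⁅x⁆∪p⁻ : y ∈ ⁅ x ⁆ ∪ p → y ≡ x ⊎ y ∈ p
∈-⁅x⁆∪p⁻ {x = x} {p = p} y∈ with x∈p∪q⁻ ⁅ x ⁆ p y∈
... | inj₁ y∈⁅x⁆ = inj₁ (x∈⁅y⁆⇒x≡y x y∈⁅x⁆)
... | inj₂ y∈p   = inj₂ y∈p

∉-⁅x⁆∪p : y ≢ x → y ∉ p → y ∉ ⁅ x ⁆ ∪ p
∉-⁅x⁆∪p y≢x y∉p y∈ with ∈-⁅x⁆∪p⁻ y∈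
... | inj₁ y≡x = y≢x y≡x
... | inj₂ y∈p = y∉p y∈p

⁅x⁆∪p⊆q : x ∈ q → p ⊆ q → ⁅ x ⁆ ∪ p ⊆ q
⁅x⁆∪p⊆q x∈q p⊆q y∈ with ∈-⁅x⁆∪p⁻ y∈
... | inj₁ refl = x∈q
... | inj₂ y∈p  = p⊆q y∈p

x∈p─q⁻ : ∀ (p q : Subset n) → x ∈ p ─ q → x ∈ p × x ∉ q
x∈p─q⁻ {x = zero}  (inside ∷ p)  (outside ∷ q) here       = here , λ ()
x∈p─q⁻ {x = zero}  (inside ∷ p)  (inside ∷ q)  ()
x∈p─q⁻ {x = zero}  (outside ∷ p) (inside ∷ q)  ()
x∈p─q⁻ {x = zero}  (outside ∷ p) (outside ∷ q) ()
x∈p─q⁻ {x = suc x} (_ ∷ p)       (_ ∷ q)       (there x∈) with x∈p─q⁻ p q x∈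
... | x∈p , x∉q = there x∈p , λ { (there x∈q) → x∉q x∈q }

∪-lub : p ⊆ s → q ⊆ s → p ∪ q ⊆ s
∪-lub {p = p} {q = q} p⊆s q⊆s x∈ with x∈p∪q⁻ p q x∈
... | inj₁ x∈p = p⊆s x∈p
... | inj₂ x∈q = q⊆s x∈q

∪-monoʳ-⊆ : q ⊆ s → p ∪ q ⊆ p ∪ s
∪-monoʳ-⊆ {q = q} {p = p} q⊆s x∈ with x∈p∪q⁻ p q x∈
... | inj₁ x∈p = p⊆p∪q _ x∈p
... | inj₂ x∈q = q⊆p∪q p _ (q⊆s x∈q)

∪-swap-⊆ : p ∪ q ∪ s ⊆ q ∪ p ∪ s
∪-swap-⊆ {p = p} {q = q} {s = s} x∈ with x∈p∪q⁻ p (q ∪ s) x∈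
... | inj₁ x∈p = q⊆p∪q q _ (p⊆p∪q s x∈p)
... | inj₂ x∈q∪s with x∈p∪q⁻ q s x∈q∪s
...   | inj₁ x∈q = p⊆p∪q _ x∈q
...   | inj₂ x∈s = q⊆p∪q q _ (q⊆p∪q p s x∈s)

x∈p⇒⁅x⁆⊆p : x ∈ p → ⁅ x ⁆ ⊆ p
x∈p⇒⁅x⁆⊆p {x = x} x∈p y∈ with x∈⁅y⁆⇒x≡y x y∈
... | refl = x∈p

y∈p-x⁻ : y ∈ p - x → y ∈ p × y ≢ x
y∈p-x⁻ {p = p} {x = x} y∈ with x∈p─q⁻ p ⁅ x ⁆ y∈
... | y∈p , y∉⁅x⁆ = y∈p , λ { refl → y∉⁅x⁆ (x∈⁅x⁆ x) }

p⊆⁅x⁆∪[p-x] : p ⊆ ⁅ x ⁆ ∪ (p - x)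
p⊆⁅x⁆∪[p-x] {x = x} {y} y∈p with y ≟ᶠ x
... | yes refl = x∈⁅x⁆∪p
... | no y≢x   = p⊆⁅x⁆∪p (x∈p∧x≢y⇒x∈p-y y∈p y≢x)

∣⁅x⁆∪p∣≡1+∣p∣ : x ∉ p → ∣ ⁅ x ⁆ ∪ p ∣ ≡ suc ∣ p ∣
∣⁅x⁆∪p∣≡1+∣p∣ {x = zero}  {p = outside ∷ p} _   = cong suc (cong ∣_∣ (∪-identityˡ p))
∣⁅x⁆∪p∣≡1+∣p∣ {x = zero}  {p = inside ∷ p}  x∉p = contradiction here x∉p
∣⁅x⁆∪p∣≡1+∣p∣ {x = suc x} {p = outside ∷ p} x∉p = ∣⁅x⁆∪p∣≡1+∣p∣ (λ x∈p → x∉p (there x∈p))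
∣⁅x⁆∪p∣≡1+∣p∣ {x = suc x} {p = inside ∷ p}  x∉p = cong suc (∣⁅x⁆∪p∣≡1+∣p∣ (λ x∈p → x∉p (there x∈p)))

∣⁅x⁆∪p∣≤1+∣p∣ : ∀ x (p : Subset n) → ∣ ⁅ x ⁆ ∪ p ∣ ≤ suc ∣ p ∣
∣⁅x⁆∪p∣≤1+∣p∣ x p with x ∈? p
... | no x∉p = ≤-reflexive (∣⁅x⁆∪p∣≡1+∣p∣ x∉p)
... | yes x∈p = ≤-trans (p⊆q⇒∣p∣≤∣q∣ (⁅x⁆∪p⊆q x∈p ⊆-refl)) (n≤1+n _)

∣⁅x,y⁆∣≡2 : x ≢ y → ∣ ⁅ x ⁆ ∪ ⁅ y ⁆ ∣ ≡ 2
∣⁅x,y⁆∣≡2 {y = y} x≢y = trans (∣⁅x⁆∪p∣≡1+∣p∣ (x≢y⇒x∉⁅y⁆ x≢y)) (cong suc (∣⁅x⁆∣≡1 y))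

∣⁅x,y⁆∣≤2 : ∀ (x y : Fin n) → ∣ ⁅ x ⁆ ∪ ⁅ y ⁆ ∣ ≤ 2
∣⁅x,y⁆∣≤2 x y = ≤-trans (∣⁅x⁆∪p∣≤1+∣p∣ x ⁅ y ⁆) (s≤s (≤-reflexive (∣⁅x⁆∣≡1 y)))

∣⁅x,y,z⁆∣≡3 : ∀ {z : Fin n} → x ≢ y → x ≢ z → y ≢ z → ∣ ⁅ x ⁆ ∪ ⁅ y ⁆ ∪ ⁅ z ⁆ ∣ ≡ 3
∣⁅x,y,z⁆∣≡3 x≢y x≢z y≢z = trans (∣⁅x⁆∪p∣≡1+∣p∣ (∉-⁅x⁆∪p x≢y (x≢y⇒x∉⁅y⁆ x≢z))) (cong suc (∣⁅x,y⁆∣≡2 y≢z))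

1+∣p-x∣≡∣p∣ : x ∈ p → suc ∣ p - x ∣ ≡ ∣ p ∣
1+∣p-x∣≡∣p∣ {x = zero}  {p = inside ∷ p}  here       = cong suc (cong ∣_∣ (p─⊥≡p p))
1+∣p-x∣≡∣p∣ {x = suc x} {p = inside ∷ p}  (there x∈) = cong suc (1+∣p-x∣≡∣p∣ x∈)
1+∣p-x∣≡∣p∣ {x = suc x} {p = outside ∷ p} (there x∈) = 1+∣p-x∣≡∣p∣ x∈

2+∣p-x-y∣≡∣p∣ : x ∈ p → y ∈ p → x ≢ y → suc (suc ∣ p - x - y ∣) ≡ ∣ p ∣
2+∣p-x-y∣≡∣p∣ x∈p y∈p x≢y = trans (cong suc (1+∣p-x∣≡∣p∣ (x∈p∧x≢y⇒x∈p-y y∈p (x≢y ∘ sym)))) (1+∣p-x∣≡∣p∣ x∈p)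

p⊆q∧∣q∣≤∣p∣⇒q⊆p : p ⊆ q → ∣ q ∣ ≤ ∣ p ∣ → q ⊆ p
p⊆q∧∣q∣≤∣p∣⇒q⊆p {p = p} {q = q} p⊆q ∣q∣≤∣p∣ {x} x∈q with x ∈? p
... | yes x∈p = x∈p
... | no x∉p  = contradiction (≤-<-trans ∣q∣≤∣p∣ ∣p∣<∣q∣) (<-irrefl refl)
  where
  p⊆q-x : p ⊆ q - x
  p⊆q-x {y} y∈p = x∈p∧x≢y⇒x∈p-y (p⊆q y∈p) λ { refl → x∉p y∈p }
  ∣p∣<∣q∣ : ∣ p ∣ < ∣ q ∣
  ∣p∣<∣q∣ = ≤-<-trans (p⊆q⇒∣p∣≤∣q∣ p⊆q-x) (x∈p⇒∣p-x∣<∣p∣ x∈q)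

∣p∣>0⇒nonempty : ∀ (p : Subset n) → 0 < ∣ p ∣ → Nonempty p
∣p∣>0⇒nonempty (inside ∷ p)  _ = zero , here
∣p∣>0⇒nonempty (outside ∷ p) 0<∣p∣ with ∣p∣>0⇒nonempty p 0<∣p∣
... | x , x∈p = suc x , there x∈p

subset-of-size : ∀ (p : Subset n) {k} → k ≤ ∣ p ∣ → ∃ λ q → q ⊆ p × ∣ q ∣ ≡ k
subset-of-size {n} p {zero} _ = ∅ , ⊥⊆ , ∣⊥∣≡0 n
subset-of-size (outside ∷ p) {suc k} k≤ with subset-of-size p k≤
... | q , q⊆p , ∣q∣≡k = outside ∷ q , (λ { (there x∈q) → there (q⊆p x∈q) }) , ∣q∣≡k
subset-of-size (inside ∷ p) {suc k} (s≤s k≤) with subset-of-size p k≤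
... | q , q⊆p , ∣q∣≡k =
  inside ∷ q , (λ { here → here ; (there x∈q) → there (q⊆p x∈q) }) , cong suc ∣q∣≡k

enum : ∀ (p : Subset n) → Fin ∣ p ∣ → Fin n
enum (inside ∷ p)  zero    = zero
enum (inside ∷ p)  (suc i) = suc (enum p i)
enum (outside ∷ p) i       = suc (enum p i)

enum-∈ : ∀ (p : Subset n) i → enum p i ∈ p
enum-∈ (inside ∷ p)  zero    = here
enum-∈ (inside ∷ p)  (suc i) = there (enum-∈ p i)
enum-∈ (outside ∷ p) i       = there (enum-∈ p i)

enum-injective : ∀ (p : Subset n) → Injective _≡_ _≡_ (enum p)
enum-injective (inside ∷ p)  {zero}  {zero}  _  = refl
enum-injective (inside ∷ p)  {suc i} {suc j} eq = cong suc (enum-injective p (suc-injective eq))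
enum-injective (outside ∷ p)                 eq = enum-injective p (suc-injective eq)

enum-surjective : ∀ (p : Subset n) → x ∈ p → ∃ λ i → enum p i ≡ x
enum-surjective (inside ∷ p)  here = zero , refl
enum-surjective (inside ∷ p)  (there x∈p) with enum-surjective p x∈p
... | i , refl = suc i , refl
enum-surjective (outside ∷ p) (there x∈p) with enum-surjective p x∈p
... | i , refl = i , refl

injection⇒∣p∣≤∣q∣ : ∀ {n′} {q : Subset n′} (f : ∀ {x} → x ∈ p → Fin n′) →
                    (∀ {x} (x∈p : x ∈ p) → f x∈p ∈ q) →
                    (∀ {x y} (x∈p : x ∈ p) (y∈p : y ∈ p) → f x∈p ≡ f y∈p → x ≡ y) →
                    ∣ p ∣ ≤ ∣ q ∣
injection⇒∣p∣≤∣q∣ {p = p} {q = q} f f∈q f-inj = injective⇒≤ φ-injective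
  where
  φ : Fin ∣ p ∣ → Fin ∣ q ∣
  φ i = proj₁ (enum-surjective q (f∈q (enum-∈ p i)))
  φ-injective : Injective _≡_ _≡_ φ
  φ-injective {i} {j} φi≡φj = enum-injective p (f-inj (enum-∈ p i) (enum-∈ p j) (begin
    f (enum-∈ p i)         ≡⟨ proj₂ (enum-surjective q (f∈q (enum-∈ p i))) ⟨
    enum q (φ i)           ≡⟨ cong (enum q) φi≡φj ⟩
    enum q (φ j)           ≡⟨ proj₂ (enum-surjective q (f∈q (enum-∈ p j))) ⟩
    f (enum-∈ p j)         ∎))
    where open ≡-Reasoning

module _ {ℓ} {P : Pred (Fin n) ℓ} (P? : Decidable P) where

  select : Subset n
  select = tabulate (λ x → does (P? x))

  ∈-select⁺ : P x → x ∈ select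
  ∈-select⁺ {x} Px = lookup⇒[]= x select (trans (lookup∘tabulate _ x) (does-true (P? x)))
    where
    does-true : (d : Dec (P x)) → does d ≡ true
    does-true (yes _)  = refl
    does-true (no ¬Px) = contradiction Px ¬Px

  ∈-select⁻ : x ∈ select → P x
  ∈-select⁻ {x} x∈ = true-does (P? x) (trans (sym (lookup∘tabulate _ x)) ([]=⇒lookup x∈))
    where
    true-does : (d : Dec (P x)) → does d ≡ true → P x
    true-does (yes Px) _ = Px
    true-does (no _)   ()

module _ {k} (f : Fin k → Fin n) where

  ∈-preimage⁺ : ∀ {i} → f i ∈ p → i ∈ preimage f p
  ∈-preimage⁺ {p = p} {i} fi∈p = lookup⇒[]= i _ (trans (lookup∘tabulate _ i) ([]=⇒lookup fi∈p))

  ∈-preimage⁻ : ∀ {i} → i ∈ preimage f p → f i ∈ p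
  ∈-preimage⁻ {p = p} {i} i∈ = lookup⇒[]= (f i) p (trans (sym (lookup∘tabulate _ i)) ([]=⇒lookup i∈))

  ∣preimage∣ : Injective _≡_ _≡_ f → (∀ {x} → x ∈ p → ∃ λ i → f i ≡ x) → ∣ preimage f p ∣ ≡ ∣ p ∣
  ∣preimage∣ {p = p} f-inj f-onto = ≤-antisym
    (injection⇒∣p∣≤∣q∣ {q = p} (λ {i} _ → f i) ∈-preimage⁻ (λ _ _ → f-inj))
    (injection⇒∣p∣≤∣q∣ (λ x∈p → proj₁ (f-onto x∈p)) preimage∈ preimage-inj)
    where
    preimage∈ : ∀ {x} (x∈p : x ∈ p) → proj₁ (f-onto x∈p) ∈ preimage f p
    preimage∈ x∈p with f-onto x∈p
    ... | i , refl = ∈-preimage⁺ x∈p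
    preimage-inj : ∀ {x y} (x∈p : x ∈ p) (y∈p : y ∈ p) → proj₁ (f-onto x∈p) ≡ proj₁ (f-onto y∈p) → x ≡ y
    preimage-inj x∈p y∈p eq with f-onto x∈p | f-onto y∈p
    ... | i , refl | j , refl = cong f eq

∣p─q∣+∣q∣≡∣p∣ : ∀ (p q : Subset n) → q ⊆ p → ∣ p ─ q ∣ + ∣ q ∣ ≡ ∣ p ∣
∣p─q∣+∣q∣≡∣p∣ []            []            _   = refl
∣p─q∣+∣q∣≡∣p∣ (inside ∷ p)  (outside ∷ q) q⊆p = cong suc (∣p─q∣+∣q∣≡∣p∣ p q (drop-∷-⊆ q⊆p))
∣p─q∣+∣q∣≡∣p∣ (outside ∷ p) (outside ∷ q) q⊆p = ∣p─q∣+∣q∣≡∣p∣ p q (drop-∷-⊆ q⊆p)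
∣p─q∣+∣q∣≡∣p∣ (inside ∷ p)  (inside ∷ q)  q⊆p =
  trans (+-suc ∣ p ─ q ∣ ∣ q ∣) (cong suc (∣p─q∣+∣q∣≡∣p∣ p q (drop-∷-⊆ q⊆p)))
∣p─q∣+∣q∣≡∣p∣ (outside ∷ p) (inside ∷ q)  q⊆p with q⊆p here
... | ()

-- Matroids

module _ {n} {I : Subset m → Set} {J : Subset n → Set} {S : Subset m} where

  isoRestr⇒∣S∣≡n : IsoRestr I S J → ∣ S ∣ ≡ n
  isoRestr⇒∣S∣≡n (f , f-inj , f∈S , f-onto , _) = begin
    ∣ S ∣              ≡⟨ ∣preimage∣ f f-inj (f-onto _) ⟨
    ∣ preimage f S ∣   ≡⟨ ≤-antisym (∣p∣≤n (preimage f S)) ∣⊤∣≤∣preimage∣ ⟩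
    n                  ∎
    where
    open ≡-Reasoning
    ∣⊤∣≤∣preimage∣ : n ≤ ∣ preimage f S ∣
    ∣⊤∣≤∣preimage∣ = subst (_≤ ∣ preimage f S ∣) (∣⊤∣≡n n) (p⊆q⇒∣p∣≤∣q∣ {p = ⊤} λ {i} _ → ∈-preimage⁺ f (f∈S i))

module _ {r : ℕ} {I : Subset m → Set} {F : Subset m} where

  uniform⇒isoRestr : (∀ {X} → X ⊆ F → I X ⇔ ∣ X ∣ ≤ r) → IsoRestr I F (UIndep r ∣ F ∣)
  uniform⇒isoRestr uniform =
    enum F , enum-injective F , enum-∈ F , (λ _ → enum-surjective F) , λ X X⊆F →
      let ∣X∣≡ = ∣preimage∣ (enum F) (enum-injective F) (λ x∈X → enum-surjective F (X⊆F x∈X))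
      in mk⇔ (λ iX → subst (_≤ r) (sym ∣X∣≡) (Equivalence.to (uniform X⊆F) iX))
             (λ ∣X∣≤r → Equivalence.from (uniform X⊆F) (subst (_≤ r) ∣X∣≡ ∣X∣≤r))

  isoRestr⇒uniform : ∀ {n} → IsoRestr I F (UIndep r n) → ∀ {X} → X ⊆ F → I X ⇔ ∣ X ∣ ≤ r
  isoRestr⇒uniform (f , f-inj , _ , f-onto , iso) {X} X⊆F =
    let ∣X∣≡ = ∣preimage∣ f f-inj (λ x∈X → f-onto _ (X⊆F x∈X))
    in mk⇔ (λ iX → subst (_≤ r) ∣X∣≡ (Equivalence.to (iso X X⊆F) iX))
           (λ ∣X∣≤r → Equivalence.from (iso X X⊆F) (subst (_≤ r) (sym ∣X∣≡) ∣X∣≤r))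

record UniformFlat (M : Matroid m) (r n : ℕ) : Set where
  field
    flat   : Subset m
    isFlat : IsFlat M flat
    iso    : IsoRestr (Indep M) flat (UIndep r n)

module _ (M : Matroid m) where

  private variable
    B F X Y Z : Subset m

  augment-by-one : Indep M Y → Indep M Z → ∣ Y ∣ < ∣ Z ∣ →
                   ∃ λ x → x ∈ Z × x ∉ Y × Indep M (⁅ x ⁆ ∪ Y)
  augment-by-one {Y} iY iZ ∣Y∣<∣Z∣ with indep-aug M iY iZ ∣Y∣<∣Z∣
  ... | x , x∈Z , x∉Y , iY∪x = x , x∈Z , x∉Y , subst (Indep M) (∪-comm Y ⁅ x ⁆) iY∪x

  record Augmentation (Y Z : Subset m) : Set where
    field
      set       : Subset m
      Y⊆set     : Y ⊆ set
      set⊆Y∪Z   : set ⊆ Y ∪ Z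
      indep     : Indep M set
      ∣set∣≡∣Z∣ : ∣ set ∣ ≡ ∣ Z ∣

  augment : Indep M Y → Indep M Z → ∣ Y ∣ ≤ ∣ Z ∣ → Augmentation Y Z
  augment {Z = Z} iY iZ ∣Y∣≤∣Z∣ = go _ iY iZ (m∸n+n≡m ∣Y∣≤∣Z∣)
    where
    go : ∀ {Y} k → Indep M Y → Indep M Z → k + ∣ Y ∣ ≡ ∣ Z ∣ → Augmentation Y Z
    go {Y} zero iY _ ∣Y∣≡∣Z∣ = record
      { set = Y ; Y⊆set = ⊆-refl ; set⊆Y∪Z = p⊆p∪q _ ; indep = iY ; ∣set∣≡∣Z∣ = ∣Y∣≡∣Z∣ }
    go {Y} (suc k) iY iZ eq with augment-by-one iY iZ (subst (∣ Y ∣ <_) eq (s≤s (m≤n+m ∣ Y ∣ k)))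
    ... | x , x∈Z , x∉Y , iY∪x = record
      { set = set ; Y⊆set = λ y∈ → Y⊆set (p⊆⁅x⁆∪p y∈) ; set⊆Y∪Z = ⊆Y∪Z ; indep = indep ; ∣set∣≡∣Z∣ = ∣set∣≡∣Z∣ }
      where
      open Augmentation (go k iY∪x iZ (trans (cong (k +_) (∣⁅x⁆∪p∣≡1+∣p∣ x∉Y)) (trans (+-suc k _) eq)))
      ⊆Y∪Z : set ⊆ Y ∪ Z
      ⊆Y∪Z y∈ with x∈p∪q⁻ _ Z (set⊆Y∪Z y∈)
      ... | inj₂ y∈Z = q⊆p∪q Y Z y∈Z
      ... | inj₁ y∈x∪Y with ∈-⁅x⁆∪p⁻ y∈x∪Y
      ...   | inj₁ refl = q⊆p∪q Y Z x∈Z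
      ...   | inj₂ y∈Y  = p⊆p∪q Z y∈Y

  ∣indep∣≤∣basis∣ : Indep M B → B ⊆ F → (∀ {y} → y ∈ F → y ∉ B → ¬ Indep M (⁅ y ⁆ ∪ B)) →
                    Indep M X → X ⊆ F → ∣ X ∣ ≤ ∣ B ∣
  ∣indep∣≤∣basis∣ {B} {X = X} iB B⊆F maximal iX X⊆F with ∣ X ∣ ≤? ∣ B ∣
  ... | yes ∣X∣≤∣B∣ = ∣X∣≤∣B∣
  ... | no ∣X∣≰∣B∣ with augment-by-one iB iX (≰⇒> ∣X∣≰∣B∣)
  ...   | x , x∈X , x∉B , iB∪x = contradiction iB∪x (maximal (X⊆F x∈X) x∉B)

module DecidableMatroid (M : Matroid m) (indep? : Decidable (Indep M)) where

  private variable
    B X : Subset m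

  private
    ∈-or-dependent? : ∀ B y → Dec (y ∈ B ⊎ ¬ Indep M (⁅ y ⁆ ∪ B))
    ∈-or-dependent? B y = y ∈? B ⊎-dec ¬? (indep? (⁅ y ⁆ ∪ B))

  closure : Subset m → Subset m
  closure B = select (∈-or-dependent? B)

  ⊆-closure : B ⊆ closure B
  ⊆-closure y∈B = ∈-select⁺ (∈-or-dependent? _) (inj₁ y∈B)

  dependent⇒∈closure : ¬ Indep M (⁅ y ⁆ ∪ B) → y ∈ closure B
  dependent⇒∈closure dep = ∈-select⁺ (∈-or-dependent? _) (inj₂ dep)

  ∈closure⇒dependent : y ∈ closure B → y ∉ B → ¬ Indep M (⁅ y ⁆ ∪ B)
  ∈closure⇒dependent y∈ y∉B with ∈-select⁻ (∈-or-dependent? _) y∈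
  ... | inj₁ y∈B = contradiction y∈B y∉B
  ... | inj₂ dep = dep

  closure-rank : Indep M B → Indep M X → X ⊆ closure B → ∣ X ∣ ≤ ∣ B ∣
  closure-rank iB iX X⊆ = ∣indep∣≤∣basis∣ M iB ⊆-closure ∈closure⇒dependent iX X⊆

  closure-isFlat : Indep M B → IsFlat M (closure B)
  closure-isFlat {B} iB x x∉ r ((J , J⊆ , iJ , ∣J∣≡r) , _) (_ , rank≤r) =
    <-irrefl refl (<-≤-trans ∣J∣<∣x∪B∣ (rank≤r _ x∪B⊆ x∪B-indep))
    where
    x∉B : x ∉ B
    x∉B x∈B = x∉ (⊆-closure x∈B)
    x∪B-indep : Indep M (⁅ x ⁆ ∪ B)
    x∪B-indep = decidable-stable (indep? _) (λ dep → x∉ (dependent⇒∈closure dep))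
    x∪B⊆ : ⁅ x ⁆ ∪ B ⊆ closure B ∪ ⁅ x ⁆
    x∪B⊆ = ⁅x⁆∪p⊆q (q⊆p∪q _ ⁅ x ⁆ (x∈⁅x⁆ x)) (λ y∈B → p⊆p∪q ⁅ x ⁆ (⊆-closure y∈B))
    ∣J∣<∣x∪B∣ : r < ∣ ⁅ x ⁆ ∪ B ∣
    ∣J∣<∣x∪B∣ = subst₂ _<_ ∣J∣≡r (sym (∣⁅x⁆∪p∣≡1+∣p∣ x∉B)) (s≤s (closure-rank iB iJ J⊆))

module SimpleMatroid (M : Matroid m) (indep? : Decidable (Indep M)) (simple : Simple M) where

  private variable
    X Y : Subset m
    a b c : Fin m

  indep-⁅x⁆ : Indep M ⁅ x ⁆
  indep-⁅x⁆ {x} = decidable-stable (indep? _) (proj₁ simple x)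

  ∣X∣≤2⇒indep : ∣ X ∣ ≤ 2 → Indep M X
  ∣X∣≤2⇒indep {X} = go (enum X) (enum-injective X) (enum-surjective X)
    where
    go : ∀ {k} (f : Fin k → Fin m) → Injective _≡_ _≡_ f →
         (∀ {x} → x ∈ X → ∃ λ i → f i ≡ x) → k ≤ 2 → Indep M X
    go {0} f _ onto _ = indep-⊆ M (λ x∈X → ⊥-elim (¬Fin0 (proj₁ (onto x∈X)))) (indep-∅ M)
    go {1} f _ onto _ = indep-⊆ M X⊆ indep-⁅x⁆
      where
      X⊆ : X ⊆ ⁅ f zero ⁆
      X⊆ x∈X with onto x∈X
      ... | zero , refl = x∈⁅x⁆ _
    go {2} f f-inj onto _ = indep-⊆ M X⊆ (decidable-stable (indep? _) not-parallel)
      where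
      X⊆ : X ⊆ ⁅ f zero ⁆ ∪ ⁅ f (suc zero) ⁆
      X⊆ x∈X with onto x∈X
      ... | zero , refl     = x∈⁅x⁆∪p
      ... | suc zero , refl = p⊆⁅x⁆∪p (x∈⁅x⁆ _)
      not-parallel : ¬ ¬ Indep M (⁅ f zero ⁆ ∪ ⁅ f (suc zero) ⁆)
      not-parallel dep = proj₂ simple _ _ ((λ eq → 0≢1+n (f-inj eq)) , indep-⁅x⁆ , indep-⁅x⁆ , dep)
    go {suc (suc (suc _))} _ _ _ (s≤s (s≤s ()))

  ⊆⁅x,y⁆⇒indep : X ⊆ ⁅ x ⁆ ∪ ⁅ y ⁆ → Indep M X
  ⊆⁅x,y⁆⇒indep {x = x} {y} X⊆ = indep-⊆ M X⊆ (∣X∣≤2⇒indep (∣⁅x,y⁆∣≤2 x y))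

  exchange : c ∈ Y → a ∉ Y → Indep M (⁅ a ⁆ ∪ Y) → ¬ Indep M (⁅ c ⁆ ∪ ⁅ a ⁆ ∪ ⁅ b ⁆) →
             Indep M (⁅ b ⁆ ∪ Y)
  exchange {c} {Y} {a} {b} c∈Y a∉Y ia∪Y dep = indep-⊆ M b∪Y⊆W indep
    where
    ∣a∪Y∣≡1+∣Y∣ : ∣ ⁅ a ⁆ ∪ Y ∣ ≡ suc ∣ Y ∣
    ∣a∪Y∣≡1+∣Y∣ = ∣⁅x⁆∪p∣≡1+∣p∣ a∉Y
    ∣b,c∣≤∣a∪Y∣ : ∣ ⁅ b ⁆ ∪ ⁅ c ⁆ ∣ ≤ ∣ ⁅ a ⁆ ∪ Y ∣
    ∣b,c∣≤∣a∪Y∣ = ≤-trans (∣⁅x,y⁆∣≤2 b c) (subst (2 ≤_) (sym ∣a∪Y∣≡1+∣Y∣)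
                    (s≤s (subst (_≤ ∣ Y ∣) (∣⁅x⁆∣≡1 c) (p⊆q⇒∣p∣≤∣q∣ (x∈p⇒⁅x⁆⊆p c∈Y)))))
    open Augmentation (augment M (⊆⁅x,y⁆⇒indep {x = b} {c} ⊆-refl) ia∪Y ∣b,c∣≤∣a∪Y∣)
    a∉W : a ∉ set
    a∉W a∈W = dep (indep-⊆ M (⁅x⁆∪p⊆q (Y⊆set (p⊆⁅x⁆∪p (x∈⁅x⁆ c)))
                               (⁅x⁆∪p⊆q a∈W (x∈p⇒⁅x⁆⊆p (Y⊆set x∈⁅x⁆∪p)))) indep)
    W⊆b∪Y : set ⊆ ⁅ b ⁆ ∪ Y
    W⊆b∪Y {y} y∈W with x∈p∪q⁻ (⁅ b ⁆ ∪ ⁅ c ⁆) _ (set⊆Y∪Z y∈W)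
    ... | inj₁ y∈b∪c with ∈-⁅x⁆∪p⁻ y∈b∪c
    ...   | inj₁ refl = x∈⁅x⁆∪p
    ...   | inj₂ y∈c  = p⊆⁅x⁆∪p (x∈p⇒⁅x⁆⊆p c∈Y y∈c)
    W⊆b∪Y {y} y∈W | inj₂ y∈a∪Y with ∈-⁅x⁆∪p⁻ y∈a∪Y
    ...   | inj₁ refl = contradiction y∈W a∉W
    ...   | inj₂ y∈Y  = p⊆⁅x⁆∪p y∈Y
    b∪Y⊆W : ⁅ b ⁆ ∪ Y ⊆ set
    b∪Y⊆W = p⊆q∧∣q∣≤∣p∣⇒q⊆p W⊆b∪Y
              (≤-trans (∣⁅x⁆∪p∣≤1+∣p∣ b Y) (≤-reflexive (sym (trans ∣set∣≡∣Z∣ ∣a∪Y∣≡1+∣Y∣))))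

-- Matroids represented over a finite field

∃-vec? : ∀ {q} k {P : Vec (Fin q) k → Set} → Decidable P → Dec (∃ P)
∃-vec? zero    P? = map′ ([] ,_) (λ { ([] , p) → p }) (P? [])
∃-vec? (suc k) P? = map′ (λ (a , as , p) → a ∷ as , p) (λ { (a ∷ as , p) → a , as , p })
                         (any? λ a → ∃-vec? k (λ as → P? (a ∷ as)))

1+[a+t]≤q+[2+t] : ∀ {a q} t → a ≤ suc q → suc (a + t) ≤ q + (2 + t)
1+[a+t]≤q+[2+t] {a} {q} t a≤1+q = begin
  suc (a + t)          ≤⟨ s≤s (+-monoˡ-≤ t a≤1+q) ⟩
  suc (suc q + t)      ≡⟨ trans (+-suc q (suc t)) (cong suc (+-suc q t)) ⟨
  q + (2 + t)        ∎
  where open ≤-Reasoning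

module RepresentedMatroid (𝔽 : CommutativeRing 0ℓ 0ℓ) (isField : IsField 𝔽) {q : ℕ} (size : HasSize 𝔽 q)
  {m : ℕ} {M : Matroid m} {d : ℕ} {v : Fin m → Fin d → CommutativeRing.Carrier 𝔽}
  (rep : RepresentedBy 𝔽 d M v) where

  open CommutativeRing 𝔽 hiding (zero; _-_)
    renaming (_+_ to _+ᶠ_; refl to ≈-refl; sym to ≈-sym; trans to ≈-trans; reflexive to ≈-reflexive)
  open CommutativeSemigroupProperties *-commutativeSemigroup using (x∙yz≈y∙xz)
  open CommutativeSemigroupProperties +-commutativeSemigroup using (interchange)
  open RingProperties ring using (-‿distribˡ-*)
  open SetoidReasoning setoid

  private
    element : Fin q → Carrier
    element = proj₁ size

    element-injective : ∀ {i j} → element i ≈ element j → i ≡ j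
    element-injective = proj₁ (proj₂ size) _ _

    index : Carrier → Fin q
    index x = proj₁ (proj₂ (proj₂ size) x)

    element∘index : ∀ x → element (index x) ≈ x
    element∘index x = proj₂ (proj₂ (proj₂ size) x)

  infix 4 _≈?_
  _≈?_ : ∀ x y → Dec (x ≈ y)
  x ≈? y = map′ (λ eq → ≈-trans (≈-sym (element∘index x))
                                (≈-trans (≈-reflexive (cong element eq)) (element∘index y)))
                (λ x≈y → element-injective (≈-trans (element∘index x) (≈-trans x≈y (≈-sym (element∘index y)))))
                (index x ≟ᶠ index y)

  1≉0 : 1# ≉ 0#
  1≉0 1≈0 = proj₁ isField (≈-sym 1≈0)

  *-nonzero : ∀ {a b} → a ≉ 0# → b ≉ 0# → a * b ≉ 0#
  *-nonzero {a} {b} a≉0 b≉0 ab≈0 with proj₂ isField a a≉0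
  ... | a⁻¹ , aa⁻¹≈1 = b≉0 (begin
    b               ≈⟨ *-identityˡ b ⟨
    1# * b          ≈⟨ *-congʳ aa⁻¹≈1 ⟨
    (a * a⁻¹) * b   ≈⟨ *-congʳ (*-comm a a⁻¹) ⟩
    (a⁻¹ * a) * b   ≈⟨ *-assoc a⁻¹ a b ⟩
    a⁻¹ * (a * b)   ≈⟨ *-congˡ ab≈0 ⟩
    a⁻¹ * 0#        ≈⟨ zeroʳ a⁻¹ ⟩
    0#              ∎)

  injective-nonzero⇒<q : (ρ : Fin k → Carrier) → (∀ i → ρ i ≉ 0#) →
                         (∀ {i j} → ρ i ≈ ρ j → i ≡ j) → suc k ≤ q
  injective-nonzero⇒<q {k} ρ ρ≉0 ρ-injective = go q refl
    where
    index0≢index∘ρ : ∀ i → index 0# ≢ index (ρ i)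
    index0≢index∘ρ i eq = ρ≉0 i (≈-trans (≈-sym (element∘index (ρ i)))
                                   (≈-trans (≈-reflexive (cong element (sym eq))) (element∘index 0#)))
    go : ∀ q′ → q′ ≡ q → suc k ≤ q
    go zero    refl = contradiction (index 0#) ¬Fin0
    go (suc _) refl = s≤s (injective⇒≤ ψ-injective)
      where
      ψ : Fin k → Fin _
      ψ i = punchOut (index0≢index∘ρ i)
      ψ-injective : Injective _≡_ _≡_ ψ
      ψ-injective {i} {j} eq = ρ-injective (begin
        ρ i                   ≈⟨ element∘index (ρ i) ⟨
        element (index (ρ i)) ≡⟨ cong element (punchOut-injective (index0≢index∘ρ i) (index0≢index∘ρ j) eq) ⟩
        element (index (ρ j)) ≈⟨ element∘index (ρ j) ⟩
        ρ j                   ∎)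

  distinct-ratios⇒<q : (a b : Fin k → Carrier) → (∀ i → a i ≉ 0#) → (∀ i → b i ≉ 0#) →
                       (∀ {i j} → i ≢ j → a i * b j ≉ a j * b i) → suc k ≤ q
  distinct-ratios⇒<q a b a≉0 b≉0 cross≉ = injective-nonzero⇒<q ρ ρ≉0 ρ-injective
    where
    a⁻¹ : ∀ i → Carrier
    a⁻¹ i = proj₁ (proj₂ isField (a i) (a≉0 i))
    ρ : ∀ i → Carrier
    ρ i = b i * a⁻¹ i
    ρ≉0 : ∀ i → ρ i ≉ 0#
    ρ≉0 i = *-nonzero (b≉0 i) λ a⁻¹≈0 → 1≉0 (begin
      1#            ≈⟨ proj₂ (proj₂ isField (a i) (a≉0 i)) ⟨
      a i * a⁻¹ i   ≈⟨ *-congˡ a⁻¹≈0 ⟩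
      a i * 0#      ≈⟨ zeroʳ (a i) ⟩
      0#            ∎)
    a*ρ≈b : ∀ i → a i * ρ i ≈ b i
    a*ρ≈b i = begin
      a i * (b i * a⁻¹ i)  ≈⟨ x∙yz≈y∙xz (a i) (b i) (a⁻¹ i) ⟩
      b i * (a i * a⁻¹ i)  ≈⟨ *-congˡ (proj₂ (proj₂ isField (a i) (a≉0 i))) ⟩
      b i * 1#             ≈⟨ *-identityʳ (b i) ⟩
      b i                  ∎
    ρ-injective : ∀ {i j} → ρ i ≈ ρ j → i ≡ j
    ρ-injective {i} {j} ρi≈ρj with i ≟ᶠ j
    ... | yes i≡j = i≡j
    ... | no i≢j  = contradiction (begin
      a i * b j          ≈⟨ *-congˡ (a*ρ≈b j) ⟨
      a i * (a j * ρ j)  ≈⟨ *-congˡ (*-congˡ ρi≈ρj) ⟨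
      a i * (a j * ρ i)  ≈⟨ x∙yz≈y∙xz (a i) (a j) (ρ i) ⟩
      a j * (a i * ρ i)  ≈⟨ *-congˡ (a*ρ≈b i) ⟩
      a j * b i          ∎) (cross≉ i≢j)

  ∑ : (Fin n → Carrier) → Carrier
  ∑ = sumF _+ᶠ_ 0#

  ∑-cong : ∀ {f h : Fin n → Carrier} → (∀ i → f i ≈ h i) → ∑ f ≈ ∑ h
  ∑-cong {zero}  _     = ≈-refl
  ∑-cong {suc n} f≈h = +-cong (f≈h zero) (∑-cong (f≈h ∘ suc))

  ∑-linear : ∀ α β (f h : Fin n → Carrier) → ∑ (λ i → α * f i +ᶠ β * h i) ≈ α * ∑ f +ᶠ β * ∑ h
  ∑-linear {zero}  α β f h = ≈-sym (≈-trans (+-cong (zeroʳ α) (zeroʳ β)) (+-identityʳ 0#))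
  ∑-linear {suc n} α β f h = begin
    (α * f zero +ᶠ β * h zero) +ᶠ ∑ (λ i → α * f (suc i) +ᶠ β * h (suc i))
      ≈⟨ +-congˡ (∑-linear α β (f ∘ suc) (h ∘ suc)) ⟩
    (α * f zero +ᶠ β * h zero) +ᶠ (α * ∑ (f ∘ suc) +ᶠ β * ∑ (h ∘ suc))
      ≈⟨ interchange _ _ _ _ ⟩
    (α * f zero +ᶠ α * ∑ (f ∘ suc)) +ᶠ (β * h zero +ᶠ β * ∑ (h ∘ suc))
      ≈⟨ +-cong (distribˡ α _ _) (distribˡ β _ _) ⟨
    α * ∑ f +ᶠ β * ∑ h ∎

  record Dependency (X : Subset m) : Set where
    field
      coeff     : Fin m → Carrier
      supported : ∀ {x} → x ∉ X → coeff x ≈ 0#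
      relation  : ∀ j → ∑ (λ x → coeff x * v x j) ≈ 0#

  open Dependency

  Nontrivial : ∀ {X} → Dependency X → Set
  Nontrivial D = ∃ λ x → coeff D x ≉ 0#

  private variable
    A X Y : Subset m

  indep⇒trivial : Indep M X → (D : Dependency X) → ∀ x → coeff D x ≈ 0#
  indep⇒trivial {X} iX D = Equivalence.to (rep X) iX (coeff D) (λ _ → supported D) (relation D)

  weaken : X ⊆ Y → Dependency X → Dependency Y
  weaken X⊆Y D = record
    { coeff = coeff D ; supported = λ x∉Y → supported D (λ x∈X → x∉Y (X⊆Y x∈X)) ; relation = relation D }

  combine : Carrier → Carrier → Dependency X → Dependency X → Dependency X
  combine α β D D′ = record
    { coeff     = λ x → α * coeff D x +ᶠ β * coeff D′ x
    ; supported = λ x∉ → ≈-trans (+-cong (≈-trans (*-congˡ (supported D x∉)) (zeroʳ α))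
                                       (≈-trans (*-congˡ (supported D′ x∉)) (zeroʳ β))) (+-identityʳ 0#)
    ; relation  = λ j → begin
        ∑ (λ x → (α * coeff D x +ᶠ β * coeff D′ x) * v x j)
          ≈⟨ ∑-cong {m} (λ x → ≈-trans (distribʳ _ _ _) (+-cong (*-assoc _ _ _) (*-assoc _ _ _))) ⟩
        ∑ (λ x → α * (coeff D x * v x j) +ᶠ β * (coeff D′ x * v x j))
          ≈⟨ ∑-linear {m} α β _ _ ⟩
        α * ∑ (λ x → coeff D x * v x j) +ᶠ β * ∑ (λ x → coeff D′ x * v x j)
          ≈⟨ +-cong (*-congˡ (relation D j)) (*-congˡ (relation D′ j)) ⟩
        α * 0# +ᶠ β * 0#
          ≈⟨ ≈-trans (+-cong (zeroʳ α) (zeroʳ β)) (+-identityʳ 0#) ⟩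
        0# ∎
    }

  private
    -- Coefficients range over Fin q ≅ 𝔽, so dependencies can be found by exhaustive search.
    FiniteDependency : Subset m → Vec (Fin q) m → Set
    FiniteDependency X c = (∀ x → x ∉ X → element (lookup c x) ≈ 0#)
                         × (∀ j → ∑ (λ x → element (lookup c x) * v x j) ≈ 0#)
                         × ∃ λ x → element (lookup c x) ≉ 0#

    finiteDependency? : ∀ X c → Dec (FiniteDependency X c)
    finiteDependency? X c = all? (λ x → ¬? (x ∈? X) →-dec (_ ≈? 0#))
                      ×-dec all? (λ j → _ ≈? 0#)
                      ×-dec any? (λ x → ¬? (_ ≈? 0#))

    toDependency : ∀ {c} → FiniteDependency X c → Σ[ D ∈ Dependency X ] Nontrivial D
    toDependency (supp , rel , nontrivial) =
      record { coeff = _ ; supported = supp _ ; relation = rel } , nontrivial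

    fromDependency : (D : Dependency X) → Nontrivial D → ∃ (FiniteDependency X)
    fromDependency D (x , Dx≉0) =
      c , (λ y y∉X → ≈-trans (lookup-c y) (supported D y∉X))
        , (λ j → ≈-trans (∑-cong (λ y → *-congʳ (lookup-c y))) (relation D j))
        , x , λ ≈0 → Dx≉0 (≈-trans (≈-sym (lookup-c x)) ≈0)
      where
      c : Vec (Fin q) m
      c = tabulate (index ∘ coeff D)
      lookup-c : ∀ y → element (lookup c y) ≈ coeff D y
      lookup-c y = ≈-trans (≈-reflexive (cong element (lookup∘tabulate _ y))) (element∘index (coeff D y))

    no-finite-dependency⇒indep : ¬ ∃ (FiniteDependency X) → Indep M X
    no-finite-dependency⇒indep {X} none = Equivalence.from (rep X) λ c supp rel x →
      decidable-stable (c x ≈? 0#) λ cx≉0 →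
        none (fromDependency (record { coeff = c ; supported = supp _ ; relation = rel }) (x , cx≉0))

  indep? : Decidable (Indep M)
  indep? X with ∃-vec? m (finiteDependency? X)
  ... | yes (c , fd) = no λ iX → let (D , x , Dx≉0) = toDependency {c = c} fd in Dx≉0 (indep⇒trivial iX D x)
  ... | no none      = yes (no-finite-dependency⇒indep none)

  dependent⇒dependency : ¬ Indep M X → Σ[ D ∈ Dependency X ] Nontrivial D
  dependent⇒dependency {X} dep with ∃-vec? m (finiteDependency? X)
  ... | yes (c , fd) = toDependency {c = c} fd
  ... | no none      = contradiction (no-finite-dependency⇒indep none) dep

  restrict : (D : Dependency X) → (∀ {x} → x ∈ X → x ∉ A → coeff D x ≈ 0#) → Dependency A
  restrict {X} {A} D vanishes = record { coeff = coeff D ; supported = supp ; relation = relation D }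
    where
    supp : ∀ {x} → x ∉ A → coeff D x ≈ 0#
    supp {x} x∉A with x ∈? X
    ... | yes x∈X = vanishes x∈X x∉A
    ... | no x∉X  = supported D x∉X

  coeff≉0 : (D : Dependency (⁅ x ⁆ ∪ A)) → Nontrivial D → Indep M A → coeff D x ≉ 0#
  coeff≉0 {x} {A} D (z , Dz≉0) iA Dx≈0 = Dz≉0 (indep⇒trivial iA (restrict D vanishes) z)
    where
    vanishes : ∀ {y} → y ∈ ⁅ x ⁆ ∪ A → y ∉ A → coeff D y ≈ 0#
    vanishes y∈ y∉A with ∈-⁅x⁆∪p⁻ y∈
    ... | inj₁ refl = Dx≈0
    ... | inj₂ y∈A  = contradiction y∈A y∉A

  private
    cancel : ∀ {x y z w} → z * w ≈ x * y → x * y +ᶠ (- z) * w ≈ 0#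
    cancel {x} {y} {z} {w} zw≈xy = begin
      x * y +ᶠ (- z) * w    ≈⟨ +-congˡ (-‿distribˡ-* z w) ⟨
      x * y +ᶠ - (z * w)    ≈⟨ +-congˡ (-‿cong zw≈xy) ⟩
      x * y +ᶠ - (x * y)    ≈⟨ -‿inverseʳ (x * y) ⟩
      0#                   ∎

  -- coeff D′ x · D - coeff D x · D′ vanishes at x, and at y by the assumed equality, so it is a
  -- dependency of the independent set X; yet its coefficient at t is coeff D′ x · coeff D t ≉ 0.
  cross-minor : ∀ {t} (D D′ : Dependency (⁅ x ⁆ ∪ ⁅ y ⁆ ∪ X)) → Indep M X →
                coeff D t ≉ 0# → coeff D′ t ≈ 0# → coeff D′ x ≉ 0# →
                coeff D x * coeff D′ y ≉ coeff D y * coeff D′ x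
  cross-minor {x} {y} {X} {t} D D′ iX Dt≉0 D′t≈0 D′x≉0 cross≈ =
    *-nonzero D′x≉0 Dt≉0 (begin
      coeff D′ x * coeff D t                               ≈⟨ +-identityʳ _ ⟨
      coeff D′ x * coeff D t +ᶠ 0#                         ≈⟨ +-congˡ (zeroʳ _) ⟨
      coeff D′ x * coeff D t +ᶠ (- coeff D x) * 0#         ≈⟨ +-congˡ (*-congˡ D′t≈0) ⟨
      coeff D′ x * coeff D t +ᶠ (- coeff D x) * coeff D′ t ≈⟨ indep⇒trivial iX (restrict E vanishes) t ⟩
      0#                                                   ∎)
    where
    E : Dependency (⁅ x ⁆ ∪ ⁅ y ⁆ ∪ X)
    E = combine (coeff D′ x) (- coeff D x) D D′
    vanishes : ∀ {z} → z ∈ ⁅ x ⁆ ∪ ⁅ y ⁆ ∪ X → z ∉ X → coeff E z ≈ 0#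
    vanishes z∈ z∉X with ∈-⁅x⁆∪p⁻ z∈
    ... | inj₁ refl = cancel (*-comm _ _)
    ... | inj₂ z∈ with ∈-⁅x⁆∪p⁻ z∈
    ...   | inj₁ refl = cancel (≈-trans cross≈ (*-comm _ _))
    ...   | inj₂ z∈X  = contradiction z∈X z∉X

  -- Over W the points of P lie on a line through y₀ and y₁; the ratios of the coefficients of
  -- y₀ and y₁ in the dependencies of the other points are distinct and non-zero.
  line-bound : ∀ {W P y₀ y₁} → y₀ ∈ P → y₁ ∈ P → y₀ ≢ y₁ →
               (∀ {y y′} → y ∈ P → y′ ∈ P → y ≢ y′ → Indep M (⁅ y ⁆ ∪ ⁅ y′ ⁆ ∪ W)) →
               (∀ {y} → y ∈ P → y ≢ y₀ → y ≢ y₁ → ¬ Indep M (⁅ y ⁆ ∪ ⁅ y₀ ⁆ ∪ ⁅ y₁ ⁆ ∪ W)) →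
               ∣ P ∣ ≤ suc q
  line-bound {W} {P} {y₀} {y₁} y₀∈P y₁∈P y₀≢y₁ pair-indep spanned =
    subst (_≤ suc q) (2+∣p-x-y∣≡∣p∣ y₀∈P y₁∈P y₀≢y₁) (s≤s (distinct-ratios⇒<q a b a≉0 b≉0 cross≉))
    where
    Q : Subset m
    Q = P - y₀ - y₁
    module _ {y} (y∈Q : y ∈ Q) where
      y∈P : y ∈ P
      y∈P = proj₁ (y∈p-x⁻ (proj₁ (y∈p-x⁻ y∈Q)))
      y≢y₀ : y ≢ y₀
      y≢y₀ = proj₂ (y∈p-x⁻ (proj₁ (y∈p-x⁻ y∈Q)))
      y≢y₁ : y ≢ y₁
      y≢y₁ = proj₂ (y∈p-x⁻ y∈Q)
      base : Indep M (⁅ y₀ ⁆ ∪ ⁅ y₁ ⁆ ∪ W)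
      base = pair-indep y₀∈P y₁∈P y₀≢y₁
      y∉W : y ∉ W
      y∉W y∈W = spanned y∈P y≢y₀ y≢y₁ (indep-⊆ M (⁅x⁆∪p⊆q (p⊆⁅x⁆∪p (p⊆⁅x⁆∪p y∈W)) ⊆-refl) base)
      D : Dependency (⁅ y ⁆ ∪ ⁅ y₀ ⁆ ∪ ⁅ y₁ ⁆ ∪ W)
      D = proj₁ (dependent⇒dependency (spanned y∈P y≢y₀ y≢y₁))
      D-nontrivial : Nontrivial D
      D-nontrivial = proj₂ (dependent⇒dependency (spanned y∈P y≢y₀ y≢y₁))
      Dy≉0 : coeff D y ≉ 0#
      Dy≉0 = coeff≉0 D D-nontrivial base
      Dy₀≉0 : coeff D y₀ ≉ 0#
      Dy₀≉0 = coeff≉0 (weaken ∪-swap-⊆ D) D-nontrivial (pair-indep y∈P y₁∈P y≢y₁)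
      Dy₁≉0 : coeff D y₁ ≉ 0#
      Dy₁≉0 = coeff≉0 (weaken (∪-swap-⊆ ∘ ∪-monoʳ-⊆ ∪-swap-⊆) D) D-nontrivial (pair-indep y∈P y₀∈P y≢y₀)
    a b : Fin ∣ Q ∣ → Carrier
    a i = coeff (D (enum-∈ Q i)) y₀
    b i = coeff (D (enum-∈ Q i)) y₁
    a≉0 : ∀ i → a i ≉ 0#
    a≉0 i = Dy₀≉0 (enum-∈ Q i)
    b≉0 : ∀ i → b i ≉ 0#
    b≉0 i = Dy₁≉0 (enum-∈ Q i)
    cross≉ : ∀ {i j} → i ≢ j → a i * b j ≉ a j * b i
    cross≉ {i} {j} i≢j cross≈ =
      cross-minor (weaken (⊆support x∈⁅x⁆∪p) (D y∈Q)) (weaken (⊆support (p⊆⁅x⁆∪p x∈⁅x⁆∪p)) (D y′∈Q))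
                  (pair-indep (y∈P y∈Q) (y∈P y′∈Q) y≢y′)
                  (Dy≉0 y∈Q) (supported (D y′∈Q) y∉support′) (Dy₀≉0 y′∈Q) (≈-trans cross≈ (*-comm _ _))
      where
      y∈Q : enum Q i ∈ Q
      y∈Q = enum-∈ Q i
      y′∈Q : enum Q j ∈ Q
      y′∈Q = enum-∈ Q j
      y≢y′ : enum Q i ≢ enum Q j
      y≢y′ eq = i≢j (enum-injective Q eq)
      ⊆support : ∀ {z} → z ∈ ⁅ enum Q i ⁆ ∪ ⁅ enum Q j ⁆ ∪ W →
                 ⁅ z ⁆ ∪ ⁅ y₀ ⁆ ∪ ⁅ y₁ ⁆ ∪ W ⊆ ⁅ y₀ ⁆ ∪ ⁅ y₁ ⁆ ∪ ⁅ enum Q i ⁆ ∪ ⁅ enum Q j ⁆ ∪ W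
      ⊆support z∈ = ⁅x⁆∪p⊆q (p⊆⁅x⁆∪p (p⊆⁅x⁆∪p z∈)) (⁅x⁆∪p⊆q x∈⁅x⁆∪p (⁅x⁆∪p⊆q (p⊆⁅x⁆∪p x∈⁅x⁆∪p)
                      (p⊆⁅x⁆∪p ∘ p⊆⁅x⁆∪p ∘ p⊆⁅x⁆∪p ∘ p⊆⁅x⁆∪p)))
      y∉support′ : enum Q i ∉ ⁅ enum Q j ⁆ ∪ ⁅ y₀ ⁆ ∪ ⁅ y₁ ⁆ ∪ W
      y∉support′ = ∉-⁅x⁆∪p y≢y′ (∉-⁅x⁆∪p (y≢y₀ y∈Q) (∉-⁅x⁆∪p (y≢y₁ y∈Q) (y∉W y∈Q)))

  -- Over C, B ∪ {u, w} is a copy of U_{|B|,|B|+2}: the ratios of the coefficients of u and w on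
  -- the elements of B are distinct and non-zero.
  general-position-bound : ∀ {C B u w} → u ≢ w → Indep M (C ∪ B) →
    (∀ {t} → t ∈ ⁅ u ⁆ ∪ ⁅ w ⁆ → ¬ Indep M (⁅ t ⁆ ∪ C ∪ B)) →
    (∀ {t k} → t ∈ ⁅ u ⁆ ∪ ⁅ w ⁆ → k ∈ B → Indep M (⁅ t ⁆ ∪ C ∪ (B - k))) →
    (∀ {k k′} → k ∈ B → k′ ∈ B → k ≢ k′ → Indep M (⁅ u ⁆ ∪ ⁅ w ⁆ ∪ C ∪ (B - k - k′))) →
    suc ∣ B ∣ ≤ q
  general-position-bound {C} {B} {u} {w} u≢w base spanned indep-but-one indep-but-two =
    distinct-ratios⇒<q a b a≉0 b≉0 cross≉
    where
    u∈ : u ∈ ⁅ u ⁆ ∪ ⁅ w ⁆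
    u∈ = x∈⁅x⁆∪p
    w∈ : w ∈ ⁅ u ⁆ ∪ ⁅ w ⁆
    w∈ = p⊆⁅x⁆∪p (x∈⁅x⁆ w)
    module _ {t} (t∈ : t ∈ ⁅ u ⁆ ∪ ⁅ w ⁆) where
      D : Dependency (⁅ t ⁆ ∪ C ∪ B)
      D = proj₁ (dependent⇒dependency (spanned t∈))
      D-nontrivial : Nontrivial D
      D-nontrivial = proj₂ (dependent⇒dependency (spanned t∈))
      t∉C∪B : t ∉ C ∪ B
      t∉C∪B t∈C∪B = spanned t∈ (indep-⊆ M (⁅x⁆∪p⊆q t∈C∪B ⊆-refl) base)
      Dk≉0 : ∀ {k} → k ∈ B → coeff D k ≉ 0#
      Dk≉0 {k} k∈B = coeff≉0 (weaken ⊆k∪ D) D-nontrivial (indep-but-one t∈ k∈B)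
        where
        ⊆k∪ : ⁅ t ⁆ ∪ C ∪ B ⊆ ⁅ k ⁆ ∪ ⁅ t ⁆ ∪ C ∪ (B - k)
        ⊆k∪ = ∪-swap-⊆ ∘ ∪-monoʳ-⊆ ∪-swap-⊆ ∘ ∪-monoʳ-⊆ (∪-monoʳ-⊆ p⊆⁅x⁆∪[p-x])
    a b : Fin ∣ B ∣ → Carrier
    a i = coeff (D u∈) (enum B i)
    b i = coeff (D w∈) (enum B i)
    a≉0 : ∀ i → a i ≉ 0#
    a≉0 i = Dk≉0 u∈ (enum-∈ B i)
    b≉0 : ∀ i → b i ≉ 0#
    b≉0 i = Dk≉0 w∈ (enum-∈ B i)
    cross≉ : ∀ {i j} → i ≢ j → a i * b j ≉ a j * b i
    cross≉ {i} {j} i≢j =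
      cross-minor (weaken (⊆support u∈) (D u∈)) (weaken (⊆support w∈) (D w∈))
                  (indep-but-two (enum-∈ B i) (enum-∈ B j) k≢k′)
                  (coeff≉0 (D u∈) (D-nontrivial u∈) base) (supported (D w∈) u∉support) (Dk≉0 w∈ (enum-∈ B i))
      where
      k≢k′ : enum B i ≢ enum B j
      k≢k′ eq = i≢j (enum-injective B eq)
      ⊆support : ∀ {t} → t ∈ ⁅ u ⁆ ∪ ⁅ w ⁆ →
                 ⁅ t ⁆ ∪ C ∪ B ⊆ ⁅ enum B i ⁆ ∪ ⁅ enum B j ⁆ ∪ ⁅ u ⁆ ∪ ⁅ w ⁆ ∪ C ∪ (B - enum B i - enum B j)
      ⊆support t∈ = ⁅x⁆∪p⊆q (p⊆⁅x⁆∪p (p⊆⁅x⁆∪p (∪-monoʳ-⊆ (p⊆p∪q _) t∈)))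
        (∪-lub (p⊆⁅x⁆∪p ∘ p⊆⁅x⁆∪p ∘ p⊆⁅x⁆∪p ∘ p⊆⁅x⁆∪p ∘ p⊆p∪q _)
               (∪-monoʳ-⊆ (∪-monoʳ-⊆ (p⊆⁅x⁆∪p ∘ p⊆⁅x⁆∪p ∘ q⊆p∪q C _) ∘ p⊆⁅x⁆∪[p-x]) ∘ p⊆⁅x⁆∪[p-x]))
      u∉support : u ∉ ⁅ w ⁆ ∪ C ∪ B
      u∉support = ∉-⁅x⁆∪p u≢w (t∉C∪B u∈)

  module UniformMinor {C S : Subset m} {r : ℕ} (uniform : ∀ {X} → X ⊆ S → Indep M (C ∪ X) ⇔ ∣ X ∣ ≤ r) where

    private
      small⇒indep : X ⊆ S → ∣ X ∣ ≤ r → Indep M (C ∪ X)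
      small⇒indep X⊆S = Equivalence.from (uniform X⊆S)

      large⇒dependent : X ⊆ S → r < ∣ X ∣ → ¬ Indep M (C ∪ X)
      large⇒dependent X⊆S r<∣X∣ i = <-irrefl refl (<-≤-trans r<∣X∣ (Equivalence.to (uniform X⊆S) i))

      two-elements : ∀ {P : Subset m} → 2 ≤ ∣ P ∣ → ∃ λ y₀ → ∃ λ y₁ → y₀ ∈ P × y₁ ∈ P × y₀ ≢ y₁
      two-elements {P} 2≤∣P∣ with ∣p∣>0⇒nonempty P (≤-trans (s≤s z≤n) 2≤∣P∣)
      ... | y₀ , y₀∈P with ∣p∣>0⇒nonempty (P - y₀) (≤-pred (subst (2 ≤_) (sym (1+∣p-x∣≡∣p∣ y₀∈P)) 2≤∣P∣))
      ...   | y₁ , y₁∈P-y₀ = y₀ , y₁ , y₀∈P , proj₁ (y∈p-x⁻ y₁∈P-y₀) , proj₂ (y∈p-x⁻ y₁∈P-y₀) ∘ sym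

    module LineOverW {W} (W⊆S : W ⊆ S) (2+∣W∣≡r : 2 + ∣ W ∣ ≡ r) where

      P : Subset m
      P = S ─ W

      private
        P⊆S : P ⊆ S
        P⊆S = proj₁ ∘ x∈p─q⁻ S W

        P∉W : ∀ {y} → y ∈ P → y ∉ W
        P∉W = proj₂ ∘ x∈p─q⁻ S W

      pair-indep : ∀ {y y′} → y ∈ P → y′ ∈ P → y ≢ y′ → Indep M (⁅ y ⁆ ∪ ⁅ y′ ⁆ ∪ C ∪ W)
      pair-indep {y} {y′} y∈P y′∈P _ = indep-⊆ M (∪-swap-⊆ ∘ ∪-monoʳ-⊆ ∪-swap-⊆)
        (small⇒indep (⁅x⁆∪p⊆q (P⊆S y∈P) (⁅x⁆∪p⊆q (P⊆S y′∈P) W⊆S))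
          (≤-trans (∣⁅x⁆∪p∣≤1+∣p∣ y _) (≤-trans (s≤s (∣⁅x⁆∪p∣≤1+∣p∣ y′ W)) (≤-reflexive 2+∣W∣≡r))))

      spanned : ∀ {y y₀ y₁} → y₀ ∈ P → y₁ ∈ P → y₀ ≢ y₁ → y ∈ P → y ≢ y₀ → y ≢ y₁ →
                ¬ Indep M (⁅ y ⁆ ∪ ⁅ y₀ ⁆ ∪ ⁅ y₁ ⁆ ∪ C ∪ W)
      spanned {y} {y₀} {y₁} y₀∈P y₁∈P y₀≢y₁ y∈P y≢y₀ y≢y₁ =
        large⇒dependent (⁅x⁆∪p⊆q (P⊆S y∈P) (⁅x⁆∪p⊆q (P⊆S y₀∈P) (⁅x⁆∪p⊆q (P⊆S y₁∈P) W⊆S)))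
          (≤-reflexive (sym ∣X∣≡1+r))
        ∘ indep-⊆ M (∪-monoʳ-⊆ (∪-monoʳ-⊆ ∪-swap-⊆) ∘ ∪-monoʳ-⊆ ∪-swap-⊆ ∘ ∪-swap-⊆)
        where
        ∣X∣≡1+r : ∣ ⁅ y ⁆ ∪ ⁅ y₀ ⁆ ∪ ⁅ y₁ ⁆ ∪ W ∣ ≡ suc r
        ∣X∣≡1+r = trans (∣⁅x⁆∪p∣≡1+∣p∣ (∉-⁅x⁆∪p y≢y₀ (∉-⁅x⁆∪p y≢y₁ (P∉W y∈P))))
                  (cong suc (trans (∣⁅x⁆∪p∣≡1+∣p∣ (∉-⁅x⁆∪p y₀≢y₁ (P∉W y₀∈P)))
                  (trans (cong suc (∣⁅x⁆∪p∣≡1+∣p∣ (P∉W y₁∈P))) 2+∣W∣≡r)))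

      1+∣S∣≤q+r : r ≤ ∣ S ∣ → suc ∣ S ∣ ≤ q + r
      1+∣S∣≤q+r r≤∣S∣ =
        let y₀ , y₁ , y₀∈P , y₁∈P , y₀≢y₁ = two-elements 2≤∣P∣
        in subst₂ _≤_ (cong suc ∣P∣+∣W∣≡∣S∣) (cong (q +_) 2+∣W∣≡r)
             (1+[a+t]≤q+[2+t] ∣ W ∣ (line-bound y₀∈P y₁∈P y₀≢y₁ pair-indep (spanned y₀∈P y₁∈P y₀≢y₁)))
        where
        ∣P∣+∣W∣≡∣S∣ : ∣ P ∣ + ∣ W ∣ ≡ ∣ S ∣
        ∣P∣+∣W∣≡∣S∣ = ∣p─q∣+∣q∣≡∣p∣ S W W⊆S
        2≤∣P∣ : 2 ≤ ∣ P ∣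
        2≤∣P∣ = +-cancelʳ-≤ (∣ W ∣) 2 (∣ P ∣) (subst₂ _≤_ (sym 2+∣W∣≡r) (sym ∣P∣+∣W∣≡∣S∣) r≤∣S∣)

    module GeneralPosition {u w B} (u∈S : u ∈ S) (w∈S : w ∈ S) (u≢w : u ≢ w)
                           (B⊆ : B ⊆ S - u - w) (∣B∣≡r : ∣ B ∣ ≡ r) where

      private
        B⊆S : B ⊆ S
        B⊆S = proj₁ ∘ y∈p-x⁻ ∘ proj₁ ∘ y∈p-x⁻ ∘ B⊆

        uw⊆S : ⁅ u ⁆ ∪ ⁅ w ⁆ ⊆ S
        uw⊆S = ⁅x⁆∪p⊆q u∈S (x∈p⇒⁅x⁆⊆p w∈S)

        uw∉B : ∀ {t} → t ∈ ⁅ u ⁆ ∪ ⁅ w ⁆ → t ∉ B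
        uw∉B t∈ t∈B with ∈-⁅x⁆∪p⁻ t∈ | y∈p-x⁻ (B⊆ t∈B)
        ... | inj₁ refl  | t∈S-u , _ = proj₂ (y∈p-x⁻ t∈S-u) refl
        ... | inj₂ t∈⁅w⁆ | _ , t≢w   = t≢w (x∈⁅y⁆⇒x≡y w t∈⁅w⁆)

      base : Indep M (C ∪ B)
      base = small⇒indep B⊆S (≤-reflexive ∣B∣≡r)

      spanned : ∀ {t} → t ∈ ⁅ u ⁆ ∪ ⁅ w ⁆ → ¬ Indep M (⁅ t ⁆ ∪ C ∪ B)
      spanned t∈ = large⇒dependent (⁅x⁆∪p⊆q (uw⊆S t∈) B⊆S)
                     (subst (r <_) (sym (trans (∣⁅x⁆∪p∣≡1+∣p∣ (uw∉B t∈)) (cong suc ∣B∣≡r))) ≤-refl)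
                   ∘ indep-⊆ M ∪-swap-⊆

      indep-but-one : ∀ {t k} → t ∈ ⁅ u ⁆ ∪ ⁅ w ⁆ → k ∈ B → Indep M (⁅ t ⁆ ∪ C ∪ (B - k))
      indep-but-one {t} t∈ k∈B = indep-⊆ M ∪-swap-⊆ (small⇒indep (⁅x⁆∪p⊆q (uw⊆S t∈) (B⊆S ∘ proj₁ ∘ y∈p-x⁻))
        (≤-trans (∣⁅x⁆∪p∣≤1+∣p∣ t _) (≤-reflexive (trans (1+∣p-x∣≡∣p∣ k∈B) ∣B∣≡r))))

      indep-but-two : ∀ {k k′} → k ∈ B → k′ ∈ B → k ≢ k′ → Indep M (⁅ u ⁆ ∪ ⁅ w ⁆ ∪ C ∪ (B - k - k′))
      indep-but-two k∈B k′∈B k≢k′ = indep-⊆ M (∪-swap-⊆ ∘ ∪-monoʳ-⊆ ∪-swap-⊆)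
        (small⇒indep (⁅x⁆∪p⊆q u∈S (⁅x⁆∪p⊆q w∈S (B⊆S ∘ proj₁ ∘ y∈p-x⁻ ∘ proj₁ ∘ y∈p-x⁻)))
          (≤-trans (∣⁅x⁆∪p∣≤1+∣p∣ u _) (≤-trans (s≤s (∣⁅x⁆∪p∣≤1+∣p∣ w _))
            (≤-reflexive (trans (2+∣p-x-y∣≡∣p∣ k∈B k′∈B k≢k′) ∣B∣≡r)))))

      1+r≤q : suc r ≤ q
      1+r≤q = subst (λ k → suc k ≤ q) ∣B∣≡r
                (general-position-bound u≢w base spanned indep-but-one indep-but-two)

    1+∣S∣≤q+r : 2 ≤ r → r ≤ ∣ S ∣ → suc ∣ S ∣ ≤ q + r
    1+∣S∣≤q+r 2≤r r≤∣S∣ =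
      let W , W⊆S , ∣W∣≡r-2 = subset-of-size S (≤-trans (m∸n≤m r 2) r≤∣S∣)
      in LineOverW.1+∣S∣≤q+r W⊆S (trans (cong (2 +_) ∣W∣≡r-2) (m+[n∸m]≡n 2≤r)) r≤∣S∣

    1+r≤q : suc (suc r) ≤ ∣ S ∣ → suc r ≤ q
    1+r≤q 2+r≤∣S∣ =
      let u , w , u∈S , w∈S , u≢w = two-elements (≤-trans (s≤s (s≤s z≤n)) 2+r≤∣S∣)
          B , B⊆ , ∣B∣≡r = subset-of-size (S - u - w)
            (≤-pred (≤-pred (subst (suc (suc r) ≤_) (sym (2+∣p-x-y∣≡∣p∣ u∈S w∈S u≢w)) 2+r≤∣S∣)))
      in GeneralPosition.1+r≤q u∈S w∈S u≢w B⊆ ∣B∣≡r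

-- The contraction by e

module Contraction {m} (M : Matroid m) (indep? : Decidable (Indep M)) (simple : Simple M)
  (e : Fin m) {r n : ℕ} (2≤r : 2 ≤ r) {S : Subset m} (S⊆∁e : S ⊆ ∁ ⁅ e ⁆)
  (cover : ∀ x → x ∈ ∁ ⁅ e ⁆ → ¬ Loop (ContractIndep M e) x →
           x ∈ S ⊎ ∃ λ y → y ∈ S × Parallel (ContractIndep M e) x y)
  (iso : IsoRestr (ContractIndep M e) S (UIndep r n)) where

  open DecidableMatroid M indep?
  open SimpleMatroid M indep? simple

  private variable
    T X : Subset m
    a b c : Fin m

  e∉S : e ∉ S
  e∉S e∈S = x∈∁p⇒x∉p (S⊆∁e e∈S) (x∈⁅x⁆ e)

  ∈S⇒≢e : x ∈ S → x ≢ e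
  ∈S⇒≢e x∈S refl = e∉S x∈S

  ∣S∣≡n : ∣ S ∣ ≡ n
  ∣S∣≡n = isoRestr⇒∣S∣≡n {J = UIndep r n} iso

  S-uniform : X ⊆ S → Indep M (⁅ e ⁆ ∪ X) ⇔ ∣ X ∣ ≤ r
  S-uniform {X} X⊆S = ⇔.trans (mk⇔ to from) (isoRestr⇒uniform iso X⊆S)
    where
    e∉X : e ∉ X
    e∉X = e∉S ∘ X⊆S
    to : Indep M (⁅ e ⁆ ∪ X) → ContractIndep M e X
    to ie∪X = e∉X , (λ _ → subst (Indep M) (∪-comm ⁅ e ⁆ X) ie∪X) , λ ¬ie → contradiction indep-⁅x⁆ ¬ie
    from : ContractIndep M e X → Indep M (⁅ e ⁆ ∪ X)
    from (_ , iX∪e , _) = subst (Indep M) (∪-comm X ⁅ e ⁆) (iX∪e indep-⁅x⁆)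

  -- For distinct a, b ≠ e this says that a and b are parallel in M / e.
  infix 4 _∥_
  _∥_ : Fin m → Fin m → Set
  a ∥ b = ¬ Indep M (⁅ e ⁆ ∪ ⁅ a ⁆ ∪ ⁅ b ⁆)

  ∥-sym : a ∥ b → b ∥ a
  ∥-sym {a} {b} a∥b = a∥b ∘ subst (λ Z → Indep M (⁅ e ⁆ ∪ Z)) (∪-comm ⁅ b ⁆ ⁅ a ⁆)

  ∥-irrefl : ¬ a ∥ a
  ∥-irrefl {a} a∥a = a∥a (⊆⁅x,y⁆⇒indep {x = e} {a} (∪-monoʳ-⊆ (⁅x⁆∪p⊆q (x∈⁅x⁆ a) ⊆-refl)))

  ∥⇒≢e : a ∥ b → a ≢ e
  ∥⇒≢e {b = b} a∥b refl = a∥b (⊆⁅x,y⁆⇒indep {x = e} {b} (⁅x⁆∪p⊆q x∈⁅x⁆∪p ⊆-refl))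

  ∥-trans : a ∥ b → b ∥ c → a ≢ c → a ∥ c
  ∥-trans {a} {b} {c} a∥b b∥c a≢c ie∪a∪c =
    b∥c (indep-⊆ M ∪-swap-⊆ (exchange x∈⁅x⁆∪p a∉⁅e,c⁆ (indep-⊆ M ∪-swap-⊆ ie∪a∪c) a∥b))
    where
    a∉⁅e,c⁆ : a ∉ ⁅ e ⁆ ∪ ⁅ c ⁆
    a∉⁅e,c⁆ = ∉-⁅x⁆∪p (∥⇒≢e a∥b) (x≢y⇒x∉⁅y⁆ a≢c)

  Represents : Fin m → Fin m → Set
  Represents s x = x ≡ s ⊎ x ∥ s

  representative : x ≢ e → ∃ λ s → s ∈ S × Represents s x
  representative {x} x≢e with cover x (x∉p⇒x∈∁p (x≢y⇒x∉⁅y⁆ x≢e)) (λ loop → loop x-indep)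
    where
    x-indep : ContractIndep M e ⁅ x ⁆
    x-indep = x≢y⇒x∉⁅y⁆ (x≢e ∘ sym) , (λ _ → ⊆⁅x,y⁆⇒indep ⊆-refl) , λ ¬ie → contradiction indep-⁅x⁆ ¬ie
  ... | inj₁ x∈S = x , x∈S , inj₁ refl
  ... | inj₂ (s , s∈S , _ , _ , _ , ¬x∪s-indep) = s , s∈S , inj₂ x∥s
    where
    x∥s : x ∥ s
    x∥s ie∪x∪s = ¬x∪s-indep
      ( ∉-⁅x⁆∪p (x≢e ∘ sym) (x≢y⇒x∉⁅y⁆ (∈S⇒≢e s∈S ∘ sym))
      , (λ _ → subst (Indep M) (∪-comm ⁅ e ⁆ _) ie∪x∪s)
      , λ ¬ie → contradiction indep-⁅x⁆ ¬ie )

  same-representative : ∀ {s} → Represents s x → Represents s y → x ≢ y → x ∥ y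
  same-representative (inj₁ refl) (inj₁ refl) x≢y = contradiction refl x≢y
  same-representative (inj₁ refl) (inj₂ y∥x)  _   = ∥-sym y∥x
  same-representative (inj₂ x∥y)  (inj₁ refl) _   = x∥y
  same-representative (inj₂ x∥s)  (inj₂ y∥s)  x≢y = ∥-trans x∥s (∥-sym y∥s) x≢y

  Transversal : Subset m → Set
  Transversal T = e ∉ T × (∀ {x y} → x ∈ T → y ∈ T → x ≢ y → ¬ x ∥ y)

  transversal-⊆ : X ⊆ T → Transversal T → Transversal X
  transversal-⊆ X⊆T (e∉T , no-parallel) = e∉T ∘ X⊆T , λ x∈X y∈X → no-parallel (X⊆T x∈X) (X⊆T y∈X)

  insert-transversal : y ≢ e → (∀ {z} → z ∈ T → ¬ y ∥ z) → Transversal T → Transversal (⁅ y ⁆ ∪ T)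
  insert-transversal {y = y} {T = T} y≢e y∦ (e∉T , no-parallel) = ∉-⁅x⁆∪p (y≢e ∘ sym) e∉T , pairs
    where
    pairs : a ∈ ⁅ y ⁆ ∪ T → b ∈ ⁅ y ⁆ ∪ T → a ≢ b → ¬ a ∥ b
    pairs a∈ b∈ a≢b with ∈-⁅x⁆∪p⁻ a∈ | ∈-⁅x⁆∪p⁻ b∈
    ... | inj₁ refl | inj₁ refl = contradiction refl a≢b
    ... | inj₁ refl | inj₂ b∈T  = y∦ b∈T
    ... | inj₂ a∈T  | inj₁ refl = y∦ a∈T ∘ ∥-sym
    ... | inj₂ a∈T  | inj₂ b∈T  = no-parallel a∈T b∈T a≢b

  S-transversal : Transversal S
  S-transversal = e∉S , λ {x} {y} x∈S y∈S _ x∥y →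
    x∥y (Equivalence.from (S-uniform (⁅x⁆∪p⊆q x∈S (x∈p⇒⁅x⁆⊆p y∈S))) (≤-trans (∣⁅x,y⁆∣≤2 x y) 2≤r))

  ∣transversal∣≤n : Transversal T → ∣ T ∣ ≤ n
  ∣transversal∣≤n {T} (e∉T , no-parallel) =
    subst (∣ T ∣ ≤_) ∣S∣≡n (injection⇒∣p∣≤∣q∣ (proj₁ ∘ rep) (proj₁ ∘ proj₂ ∘ rep) rep-injective)
    where
    rep : x ∈ T → ∃ λ s → s ∈ S × Represents s x
    rep x∈T = representative λ { refl → e∉T x∈T }
    rep-injective : (x∈T : x ∈ T) (y∈T : y ∈ T) → proj₁ (rep x∈T) ≡ proj₁ (rep y∈T) → x ≡ y
    rep-injective {x} {y} x∈T y∈T with rep x∈T | rep y∈T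
    ... | _ , _ , s-represents-x | _ , _ , s-represents-y = λ { refl →
      decidable-stable (x ≟ᶠ y) λ x≢y →
        no-parallel x∈T y∈T x≢y (same-representative s-represents-x s-represents-y x≢y) }

  module ReplaceOne {T x s} (T-transversal : Transversal T) (x∈T : x ∈ T) (x∉S : x ∉ S)
                    (s∈S : s ∈ S) (x∥s : x ∥ s) where

    private
      e∉T : e ∉ T
      e∉T = proj₁ T-transversal
      no-parallel : a ∈ T → b ∈ T → a ≢ b → ¬ a ∥ b
      no-parallel = proj₂ T-transversal

      s∉T : s ∉ T
      s∉T s∈T = no-parallel x∈T s∈T (λ { refl → ∥-irrefl x∥s }) x∥s

      T-x⊆T : T - x ⊆ T
      T-x⊆T = proj₁ ∘ y∈p-x⁻

    T′ : Subset m
    T′ = ⁅ s ⁆ ∪ (T - x)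

    transversal : Transversal T′
    transversal = insert-transversal (∈S⇒≢e s∈S) s∦ (transversal-⊆ T-x⊆T T-transversal)
      where
      s∦ : y ∈ T - x → ¬ s ∥ y
      s∦ {y} y∈ s∥y = no-parallel x∈T (T-x⊆T y∈) x≢y (∥-trans x∥s s∥y x≢y)
        where
        x≢y : x ≢ y
        x≢y = proj₂ (y∈p-x⁻ y∈) ∘ sym

    ∣T′∣≡∣T∣ : ∣ T′ ∣ ≡ ∣ T ∣
    ∣T′∣≡∣T∣ = trans (∣⁅x⁆∪p∣≡1+∣p∣ (s∉T ∘ T-x⊆T)) (1+∣p-x∣≡∣p∣ x∈T)

    ∣T′─S∣<∣T─S∣ : ∣ T′ ─ S ∣ < ∣ T ─ S ∣
    ∣T′─S∣<∣T─S∣ = ≤-<-trans (p⊆q⇒∣p∣≤∣q∣ T′─S⊆) (x∈p⇒∣p-x∣<∣p∣ (x∈p∧x∉q⇒x∈p─q x∈T x∉S))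
      where
      T′─S⊆ : T′ ─ S ⊆ (T ─ S) - x
      T′─S⊆ z∈ with x∈p─q⁻ T′ S z∈
      ... | z∈T′ , z∉S with ∈-⁅x⁆∪p⁻ z∈T′
      ...   | inj₁ refl = contradiction s∈S z∉S
      ...   | inj₂ z∈T-x = x∈p∧x≢y⇒x∈p-y (x∈p∧x∉q⇒x∈p─q (T-x⊆T z∈T-x) z∉S) (proj₂ (y∈p-x⁻ z∈T-x))

    indep⇔ : Indep M (⁅ e ⁆ ∪ T) ⇔ Indep M (⁅ e ⁆ ∪ T′)
    indep⇔ = mk⇔ to from
      where
      rest : Subset m
      rest = ⁅ e ⁆ ∪ (T - x)
      x∉rest : x ∉ rest
      x∉rest = ∉-⁅x⁆∪p (λ { refl → e∉T x∈T }) (λ x∈ → proj₂ (y∈p-x⁻ x∈) refl)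
      s∉rest : s ∉ rest
      s∉rest = ∉-⁅x⁆∪p (∈S⇒≢e s∈S) (s∉T ∘ T-x⊆T)
      x∪rest⊆e∪T : ⁅ x ⁆ ∪ rest ⊆ ⁅ e ⁆ ∪ T
      x∪rest⊆e∪T = ⁅x⁆∪p⊆q (p⊆⁅x⁆∪p x∈T) (∪-monoʳ-⊆ T-x⊆T)
      e∪T⊆x∪rest : ⁅ e ⁆ ∪ T ⊆ ⁅ x ⁆ ∪ rest
      e∪T⊆x∪rest = ⁅x⁆∪p⊆q (p⊆⁅x⁆∪p x∈⁅x⁆∪p) (∪-monoʳ-⊆ p⊆⁅x⁆∪p ∘ p⊆⁅x⁆∪[p-x])
      to : Indep M (⁅ e ⁆ ∪ T) → Indep M (⁅ e ⁆ ∪ T′)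
      to = indep-⊆ M ∪-swap-⊆ ∘ (λ i → exchange x∈⁅x⁆∪p x∉rest i x∥s) ∘ indep-⊆ M x∪rest⊆e∪T
      from : Indep M (⁅ e ⁆ ∪ T′) → Indep M (⁅ e ⁆ ∪ T)
      from = indep-⊆ M e∪T⊆x∪rest ∘ (λ i → exchange x∈⁅x⁆∪p s∉rest i (∥-sym x∥s)) ∘ indep-⊆ M ∪-swap-⊆

  record Replacement (T : Subset m) : Set where
    field
      set       : Subset m
      set⊆S     : set ⊆ S
      ∣set∣≡∣T∣ : ∣ set ∣ ≡ ∣ T ∣
      indep⇔    : Indep M (⁅ e ⁆ ∪ T) ⇔ Indep M (⁅ e ⁆ ∪ set)

  replacement : Transversal T → Replacement T
  replacement {T} T-transversal = go (suc ∣ T ─ S ∣) T-transversal ≤-refl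
    where
    go : ∀ fuel {T} → Transversal T → ∣ T ─ S ∣ < fuel → Replacement T
    go (suc fuel) {T} T-transversal (s≤s ∣T─S∣≤fuel) with any? (λ x → x ∈? T ×-dec ¬? (x ∈? S))
    ... | no none = record { set = T ; set⊆S = T⊆S ; ∣set∣≡∣T∣ = refl ; indep⇔ = ⇔.refl }
      where
      T⊆S : T ⊆ S
      T⊆S {x} x∈T = decidable-stable (x ∈? S) λ x∉S → none (x , x∈T , x∉S)
    ... | yes (x , x∈T , x∉S) with representative {x} (λ { refl → proj₁ T-transversal x∈T })
    ...   | s , s∈S , inj₁ refl = contradiction s∈S x∉S
    ...   | s , s∈S , inj₂ x∥s = record
      { set = set ; set⊆S = set⊆S ; ∣set∣≡∣T∣ = trans ∣set∣≡∣T∣ ∣T′∣≡∣T∣ ; indep⇔ = ⇔.trans indep⇔ R.indep⇔ }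
      where
      open ReplaceOne T-transversal x∈T x∉S s∈S x∥s
      module R = Replacement (go fuel transversal (<-≤-trans ∣T′─S∣<∣T─S∣ ∣T─S∣≤fuel))
      open R using (set; set⊆S; ∣set∣≡∣T∣)

  transversal-indep⇔ : Transversal T → Indep M (⁅ e ⁆ ∪ T) ⇔ ∣ T ∣ ≤ r
  transversal-indep⇔ T-transversal =
    ⇔.trans indep⇔ (⇔.trans (S-uniform set⊆S) (mk⇔ (subst (_≤ r) ∣set∣≡∣T∣) (subst (_≤ r) (sym ∣set∣≡∣T∣))))
    where open Replacement (replacement T-transversal)

  rank≤1+r : Indep M X → ∣ X ∣ ≤ suc r
  rank≤1+r {X} iX with ∣ X ∣ in ∣X∣≡
  ... | zero = z≤n
  ... | suc k = subst (_≤ suc r) (trans (trans (1+∣p-x∣≡∣p∣ e∈W) ∣set∣≡∣Z∣) ∣X∣≡) (s≤s ∣W-e∣≤r)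
    where
    open Augmentation (augment M (indep-⁅x⁆ {e}) iX (subst₂ _≤_ (sym (∣⁅x⁆∣≡1 e)) (sym ∣X∣≡) (s≤s z≤n)))
    e∈W : e ∈ set
    e∈W = Y⊆set (x∈⁅x⁆ e)
    W-e-transversal : Transversal (set - e)
    W-e-transversal = (λ e∈ → proj₂ (y∈p-x⁻ e∈) refl) , λ x∈ y∈ _ x∥y →
      x∥y (indep-⊆ M (⁅x⁆∪p⊆q e∈W (⁅x⁆∪p⊆q (proj₁ (y∈p-x⁻ x∈)) (x∈p⇒⁅x⁆⊆p (proj₁ (y∈p-x⁻ y∈))))) indep)
    ∣W-e∣≤r : ∣ set - e ∣ ≤ r
    ∣W-e∣≤r = Equivalence.to (transversal-indep⇔ W-e-transversal)
                (indep-⊆ M (⁅x⁆∪p⊆q e∈W (proj₁ ∘ y∈p-x⁻)) indep)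

  transversal? : Decidable Transversal
  transversal? T = map′ (λ (e∉T , pairs) → e∉T , λ x∈T y∈T → pairs _ _ x∈T y∈T)
                        (λ (e∉T , pairs) → e∉T , λ _ _ x∈T y∈T → pairs x∈T y∈T)
    (¬? (e ∈? T) ×-dec all? λ x → all? λ y →
      x ∈? T →-dec y ∈? T →-dec ¬? (x ≟ᶠ y) →-dec ¬? (¬? (indep? (⁅ e ⁆ ∪ ⁅ x ⁆ ∪ ⁅ y ⁆))))

  DependentTransversal : Set
  DependentTransversal = ∃ λ T → Transversal T × ∣ T ∣ ≡ suc r × ¬ Indep M T

  dependent-transversal? : Dec DependentTransversal
  dependent-transversal? = anySubset? λ T → transversal? T ×-dec ∣ T ∣ ≟ suc r ×-dec ¬? (indep? T)

  module DependentTransversalFlat {T t₀} (T-transversal : Transversal T) (∣T∣≡1+r : ∣ T ∣ ≡ suc r)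
                                  (T-dependent : ¬ Indep M T) (t₀∈T : t₀ ∈ T) where

    B : Subset m
    B = T - t₀

    ∣B∣≡r : ∣ B ∣ ≡ r
    ∣B∣≡r = cong pred (trans (1+∣p-x∣≡∣p∣ t₀∈T) ∣T∣≡1+r)

    e∪B-indep : Indep M (⁅ e ⁆ ∪ B)
    e∪B-indep = Equivalence.from (transversal-indep⇔ (transversal-⊆ (proj₁ ∘ y∈p-x⁻) T-transversal))
                                 (≤-reflexive ∣B∣≡r)

    e∉B : e ∉ B
    e∉B = proj₁ T-transversal ∘ proj₁ ∘ y∈p-x⁻ {p = T} {x = t₀}

    B-indep : Indep M B
    B-indep = indep-⊆ M p⊆⁅x⁆∪p e∪B-indep

    F : Subset m
    F = closure B

    T⊆F : T ⊆ F
    T⊆F = ⁅x⁆∪p⊆q (dependent⇒∈closure (T-dependent ∘ indep-⊆ M (p⊆⁅x⁆∪[p-x] {x = t₀}))) ⊆-closure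
          ∘ p⊆⁅x⁆∪[p-x] {x = t₀}

    F-rank : Indep M X → X ⊆ F → ∣ X ∣ ≤ r
    F-rank {X} iX X⊆F = subst (∣ X ∣ ≤_) ∣B∣≡r (closure-rank B-indep iX X⊆F)

    F-transversal : Transversal F
    F-transversal = e∉F , pairs
      where
      e∉F : e ∉ F
      e∉F e∈F = ∈closure⇒dependent e∈F e∉B e∪B-indep
      pairs : x ∈ F → y ∈ F → x ≢ y → ¬ x ∥ y
      pairs {x} {y} x∈F y∈F _ x∥y = <-irrefl refl (≤-<-trans (F-rank indep W⊆F) r<∣W∣)
        where
        ∣e∪B∣≡1+r : ∣ ⁅ e ⁆ ∪ B ∣ ≡ suc r
        ∣e∪B∣≡1+r = trans (∣⁅x⁆∪p∣≡1+∣p∣ e∉B) (cong suc ∣B∣≡r)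
        open Augmentation (augment M (⊆⁅x,y⁆⇒indep {x = x} {y} ⊆-refl) e∪B-indep
                             (≤-trans (∣⁅x,y⁆∣≤2 x y) (≤-trans 2≤r (subst (r ≤_) (sym ∣e∪B∣≡1+r) (n≤1+n r)))))
        e∉W : e ∉ set
        e∉W e∈W = x∥y (indep-⊆ M (⁅x⁆∪p⊆q e∈W Y⊆set) indep)
        W⊆F : set ⊆ F
        W⊆F z∈W = [ ⁅x⁆∪p⊆q x∈F (x∈p⇒⁅x⁆⊆p y∈F)
                  , [ (λ { refl → contradiction z∈W e∉W }) , ⊆-closure ]′ ∘ ∈-⁅x⁆∪p⁻ ]′
                  (x∈p∪q⁻ (⁅ x ⁆ ∪ ⁅ y ⁆) (⁅ e ⁆ ∪ B) (set⊆Y∪Z z∈W))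
        r<∣W∣ : r < ∣ set ∣
        r<∣W∣ = ≤-reflexive (sym (trans ∣set∣≡∣Z∣ ∣e∪B∣≡1+r))

    F-uniform : X ⊆ F → Indep M X ⇔ ∣ X ∣ ≤ r
    F-uniform X⊆F = mk⇔ (λ iX → F-rank iX X⊆F) λ ∣X∣≤r →
      indep-⊆ M p⊆⁅x⁆∪p (Equivalence.from (transversal-indep⇔ (transversal-⊆ X⊆F F-transversal)) ∣X∣≤r)

  dependent-transversal⇒flat : DependentTransversal → ∃ λ h → suc r ≤ h × h ≤ n × UniformFlat M r h
  dependent-transversal⇒flat (T , T-transversal , ∣T∣≡1+r , T-dependent)
    with ∣p∣>0⇒nonempty T (subst (0 <_) (sym ∣T∣≡1+r) (s≤s z≤n))
  ... | t₀ , t₀∈T =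
    ∣ F ∣ , subst (_≤ ∣ F ∣) ∣T∣≡1+r (p⊆q⇒∣p∣≤∣q∣ T⊆F) , ∣transversal∣≤n F-transversal ,
    record { flat = F ; isFlat = closure-isFlat B-indep ; iso = uniform⇒isoRestr F-uniform }
    where open DependentTransversalFlat T-transversal ∣T∣≡1+r T-dependent t₀∈T

  IndependentTransversals : Set
  IndependentTransversals = ∀ {T} → Transversal T → ∣ T ∣ ≡ suc r → Indep M T

  ¬dependent⇒independent : ¬ DependentTransversal → IndependentTransversals
  ¬dependent⇒independent none {T} T-transversal ∣T∣≡1+r =
    decidable-stable (indep? T) λ T-dependent → none (T , T-transversal , ∣T∣≡1+r , T-dependent)

  line : Fin m → Subset m
  line s = closure (⁅ e ⁆ ∪ ⁅ s ⁆)

  module Line {s} (s∈S : s ∈ S) where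

    e∈line : e ∈ line s
    e∈line = ⊆-closure x∈⁅x⁆∪p

    s∈line : s ∈ line s
    s∈line = ⊆-closure (p⊆⁅x⁆∪p (x∈⁅x⁆ s))

    line-uniform : X ⊆ line s → Indep M X ⇔ ∣ X ∣ ≤ 2
    line-uniform X⊆ = mk⇔ (λ iX → ≤-trans (closure-rank (⊆⁅x,y⁆⇒indep ⊆-refl) iX X⊆) (∣⁅x,y⁆∣≤2 e s))
                          ∣X∣≤2⇒indep

    line-flat : UniformFlat M 2 ∣ line s ∣
    line-flat = record
      { flat = line s ; isFlat = closure-isFlat (⊆⁅x,y⁆⇒indep ⊆-refl) ; iso = uniform⇒isoRestr line-uniform }

    ∈line⇒represents : y ∈ line s → y ≢ e → Represents s y
    ∈line⇒represents {y} y∈ y≢e with y ≟ᶠ s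
    ... | yes y≡s = inj₁ y≡s
    ... | no y≢s  = inj₂ (∈closure⇒dependent y∈ (∉-⁅x⁆∪p y≢e (x≢y⇒x∉⁅y⁆ y≢s)) ∘ indep-⊆ M ∪-swap-⊆)

    represents⇒∈line : Represents s y → y ∈ line s
    represents⇒∈line (inj₁ refl) = s∈line
    represents⇒∈line (inj₂ y∥s)  = dependent⇒∈closure (y∥s ∘ indep-⊆ M ∪-swap-⊆)

    ∈line∩S⇒≡s : y ∈ line s → y ≢ e → y ∈ S → y ≡ s
    ∈line∩S⇒≡s {y} y∈ y≢e y∈S with ∈line⇒represents y∈ y≢e
    ... | inj₁ y≡s = y≡s
    ... | inj₂ y∥s = decidable-stable (y ≟ᶠ s) λ y≢s → proj₂ S-transversal y∈S s∈S y≢s y∥s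

    collinear : a ∈ line s → b ∈ line s → c ∈ line s → a ≢ b → a ≢ c → b ≢ c →
                ¬ Indep M (⁅ a ⁆ ∪ ⁅ b ⁆ ∪ ⁅ c ⁆)
    collinear a∈ b∈ c∈ a≢b a≢c b≢c i with subst (_≤ 2) (∣⁅x,y,z⁆∣≡3 a≢b a≢c b≢c)
      (Equivalence.to (line-uniform (⁅x⁆∪p⊆q a∈ (⁅x⁆∪p⊆q b∈ (x∈p⇒⁅x⁆⊆p c∈)))) i)
    ... | s≤s (s≤s ())

    ∈line⇒∦ : y ∈ line s → y ≢ e → x ∈ S → x ≢ s → ¬ y ∥ x
    ∈line⇒∦ y∈ y≢e x∈S x≢s y∥x with ∈line⇒represents y∈ y≢e
    ... | inj₁ refl = proj₂ S-transversal s∈S x∈S (x≢s ∘ sym) y∥x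
    ... | inj₂ y∥s  = proj₂ S-transversal s∈S x∈S (x≢s ∘ sym) (∥-trans (∥-sym y∥s) y∥x (x≢s ∘ sym))

  short-lines⇒⊆S : (∀ {s} → s ∈ S → ∣ line s ∣ ≤ 2) → x ≢ e → x ∈ S
  short-lines⇒⊆S {x} short x≢e with representative x≢e
  ... | s , s∈S , inj₁ refl = s∈S
  ... | s , s∈S , inj₂ x∥s  = contradiction (<-≤-trans 2<∣line∣ (short s∈S)) (<-irrefl refl)
    where
    open Line s∈S
    x≢s : x ≢ s
    x≢s refl = ∥-irrefl x∥s
    2<∣line∣ : 2 < ∣ line s ∣
    2<∣line∣ = subst (_≤ ∣ line s ∣) (∣⁅x,y,z⁆∣≡3 x≢e x≢s (∈S⇒≢e s∈S ∘ sym))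
                 (p⊆q⇒∣p∣≤∣q∣ (⁅x⁆∪p⊆q (represents⇒∈line (inj₂ x∥s)) (⁅x⁆∪p⊆q e∈line (x∈p⇒⁅x⁆⊆p s∈line))))

  module _ (independent : IndependentTransversals) (short : ∀ {s} → s ∈ S → ∣ line s ∣ ≤ 2) where

    private
      ⊤⊆e∪S : ⊤ ⊆ ⁅ e ⁆ ∪ S
      ⊤⊆e∪S {x} _ with x ≟ᶠ e
      ... | yes refl = x∈⁅x⁆∪p
      ... | no x≢e   = p⊆⁅x⁆∪p (short-lines⇒⊆S short x≢e)

      ∌e⇒transversal : e ∉ X → Transversal X
      ∌e⇒transversal e∉X = transversal-⊆ (λ x∈X → short-lines⇒⊆S short λ { refl → e∉X x∈X }) S-transversal

    ∣⊤∣≡1+n : ∣ ⊤ {m} ∣ ≡ suc n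
    ∣⊤∣≡1+n = ≤-antisym (≤-trans (p⊆q⇒∣p∣≤∣q∣ ⊤⊆e∪S) (≤-reflexive ∣e∪S∣≡1+n))
                        (subst (_≤ ∣ ⊤ {m} ∣) ∣e∪S∣≡1+n (p⊆q⇒∣p∣≤∣q∣ {p = ⁅ e ⁆ ∪ S} (λ _ → ∈⊤)))
      where
      ∣e∪S∣≡1+n : ∣ ⁅ e ⁆ ∪ S ∣ ≡ suc n
      ∣e∪S∣≡1+n = trans (∣⁅x⁆∪p∣≡1+∣p∣ e∉S) (cong suc ∣S∣≡n)

    ground-uniform : Indep M X ⇔ ∣ X ∣ ≤ suc r
    ground-uniform {X} = mk⇔ rank≤1+r from
      where
      from : ∣ X ∣ ≤ suc r → Indep M X
      from ∣X∣≤1+r with e ∈? X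
      ... | yes e∈X = indep-⊆ M p⊆⁅x⁆∪[p-x]
        (Equivalence.from (transversal-indep⇔ (∌e⇒transversal λ e∈ → proj₂ (y∈p-x⁻ e∈) refl))
                          (≤-pred (subst (_≤ suc r) (sym (1+∣p-x∣≡∣p∣ e∈X)) ∣X∣≤1+r)))
      ... | no e∉X with m≤n⇒m<n∨m≡n ∣X∣≤1+r
      ...   | inj₁ ∣X∣≤r   =
        indep-⊆ M p⊆⁅x⁆∪p (Equivalence.from (transversal-indep⇔ (∌e⇒transversal e∉X)) (≤-pred ∣X∣≤r))
      ...   | inj₂ ∣X∣≡1+r = independent (∌e⇒transversal e∉X) ∣X∣≡1+r

    short-lines⇒uniform : UniformFlat M (suc r) (suc n)
    short-lines⇒uniform = record
      { flat   = ⊤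
      ; isFlat = λ _ x∉⊤ _ _ _ → x∉⊤ ∈⊤
      ; iso    = subst (λ k → IsoRestr (Indep M) ⊤ (UIndep (suc r) k)) ∣⊤∣≡1+n
                       (uniform⇒isoRestr λ _ → ground-uniform)
      }

-- The three cases of the theorem

Allowed : (q r n : ℕ) → ℕ → ℕ → Set
Allowed q r n r′ n′ = (∃ λ k → ∃ λ t → 3 ≤ k × k ≤ q × t ≤ q ∸ 3 × r′ ≡ 2 + t × n′ ≡ k + t)
                    ⊎ (r′ ≡ r × n′ ≡ n)
                    ⊎ (r′ ≡ r + 1 × n′ ≡ n + 1)

InducedUniform : ∀ {m} → Matroid m → (ℕ → ℕ → Set) → Set
InducedUniform {m} M allowed = Σ (Subset m) λ F → IsFlat M F ×
  (∃ λ r′ → ∃ λ n′ → allowed r′ n′ × IsoRestr (Indep M) F (UIndep r′ n′))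

induced : ∀ {m} {M : Matroid m} {allowed r′ n′} → UniformFlat M r′ n′ → allowed r′ n′ → InducedUniform M allowed
induced U allowed = flat , isFlat , _ , _ , allowed , iso
  where open UniformFlat U

small-flat-parameters : ∀ {q r h n} → 2 ≤ r → suc r ≤ h → h < n → suc n ≤ q + r → suc r ≤ q →
                        ∃ λ k → ∃ λ t → 3 ≤ k × k ≤ q × t ≤ q ∸ 3 × r ≡ 2 + t × h ≡ k + t
small-flat-parameters {q} {r} {h} 2≤r r<h h<n 1+n≤q+r r<q with m≤n⇒∃[o]m+o≡n r<h
... | a , 1+r+a≡h = 3 + a , t , m≤m+n 3 a , 3+a≤q , t≤q-3 , r≡2+t , h≡3+a+t
  where
  t : ℕ
  t = r ∸ 2
  r≡2+t : r ≡ 2 + t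
  r≡2+t = sym (m+[n∸m]≡n 2≤r)
  h≡3+a+t : h ≡ (3 + a) + t
  h≡3+a+t = trans (sym 1+r+a≡h) (trans (cong (λ x → suc x + a) r≡2+t) (cong (3 +_) (ℕₚ.+-comm t a)))
  3+a≤q : 3 + a ≤ q
  3+a≤q = +-cancelʳ-≤ r (3 + a) q (subst (_≤ q + r) 2+h≡3+a+r (≤-trans (s≤s h<n) 1+n≤q+r))
    where
    2+h≡3+a+r : suc (suc h) ≡ (3 + a) + r
    2+h≡3+a+r = trans (cong (2 +_) (sym 1+r+a≡h)) (cong (3 +_) (ℕₚ.+-comm r a))
  t≤q-3 : t ≤ q ∸ 3
  t≤q-3 = subst (_≤ q ∸ 3) (m+n∸m≡n 3 t) (∸-monoˡ-≤ 3 (subst (λ x → suc x ≤ q) r≡2+t r<q))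

line-allowed : ∀ {q r n k} → 3 ≤ k → k ≤ q → Allowed q r n 2 k
line-allowed {k = k} 3≤k k≤q = inj₁ (k , 0 , 3≤k , k≤q , z≤n , refl , sym (ℕₚ.+-identityʳ k))

ground-allowed : ∀ {q r n} → Allowed q r n (suc r) (suc n)
ground-allowed {r = r} {n} = inj₂ (inj₂ (ℕₚ.+-comm 1 r , ℕₚ.+-comm 1 n))

module Cases (𝔽 : CommutativeRing 0ℓ 0ℓ) (isField : IsField 𝔽) {q : ℕ} (size : HasSize 𝔽 q)
  {m : ℕ} {M : Matroid m} {d : ℕ} {v : Fin m → Fin d → CommutativeRing.Carrier 𝔽}
  (rep : RepresentedBy 𝔽 d M v) (simple : Simple M) (e : Fin m) {r n : ℕ} (2<r : 2 < r) (r<n : r < n)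
  {S : Subset m} (S⊆∁e : S ⊆ ∁ ⁅ e ⁆)
  (cover : ∀ x → x ∈ ∁ ⁅ e ⁆ → ¬ Loop (ContractIndep M e) x →
           x ∈ S ⊎ ∃ λ y → y ∈ S × Parallel (ContractIndep M e) x y)
  (iso : IsoRestr (ContractIndep M e) S (UIndep r n)) where

  open RepresentedMatroid 𝔽 isField size {M = M} {v = v} rep using (indep?; line-bound; module UniformMinor)
  private module C = Contraction M indep? simple e (<⇒≤ 2<r) S⊆∁e cover iso
  open C
  open C public using (dependent-transversal?)
  open SimpleMatroid M indep? simple using (exchange)

  module LongLine (independent : IndependentTransversals) {s j Z} (s∈S : s ∈ S) (j∈S : j ∈ S) (j≢s : j ≢ s)
                  (Z⊆ : Z ⊆ S - s - j) (1+∣Z∣≡r : suc ∣ Z ∣ ≡ r) where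

    open Line s∈S

    private
      Z⊆S : Z ⊆ S
      Z⊆S = proj₁ ∘ y∈p-x⁻ ∘ proj₁ ∘ y∈p-x⁻ ∘ Z⊆
      Z∌s : ∀ {z} → z ∈ Z → z ≢ s
      Z∌s = proj₂ ∘ y∈p-x⁻ ∘ proj₁ ∘ y∈p-x⁻ ∘ Z⊆
      e∉Z : e ∉ Z
      e∉Z = e∉S ∘ Z⊆S
      j∉Z : j ∉ Z
      j∉Z j∈Z = proj₂ (y∈p-x⁻ (Z⊆ j∈Z)) refl
      j∉line : j ∉ line s
      j∉line j∈line = j≢s (∈line∩S⇒≡s j∈line (∈S⇒≢e j∈S) j∈S)
      line∖e∉Z : ∀ {y} → y ∈ line s → y ≢ e → y ∉ Z
      line∖e∉Z y∈ y≢e y∈Z = Z∌s y∈Z (∈line∩S⇒≡s y∈ y≢e (Z⊆S y∈Z))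
      line∖e∦Z : ∀ {y z} → y ∈ line s → y ≢ e → z ∈ Z → ¬ y ∥ z
      line∖e∦Z y∈ y≢e z∈Z = ∈line⇒∦ y∈ y≢e (Z⊆S z∈Z) (Z∌s z∈Z)

    -- A line of M / Z with ∣ line s ∣ + 1 points.
    P : Subset m
    P = ⁅ j ⁆ ∪ line s

    private
      P∖e-transversal : ∀ {y} → y ∈ P → y ≢ e → Transversal (⁅ y ⁆ ∪ Z) × y ∉ Z
      P∖e-transversal {y} y∈P y≢e with ∈-⁅x⁆∪p⁻ y∈P
      ... | inj₁ refl = transversal-⊆ (⁅x⁆∪p⊆q j∈S Z⊆S) S-transversal , j∉Z
      ... | inj₂ y∈line =
        insert-transversal y≢e (line∖e∦Z y∈line y≢e) (transversal-⊆ Z⊆S S-transversal) , line∖e∉Z y∈line y≢e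

      with-e-indep : ∀ {y} → y ∈ P → y ≢ e → Indep M (⁅ e ⁆ ∪ ⁅ y ⁆ ∪ Z)
      with-e-indep y∈P y≢e = Equivalence.from (transversal-indep⇔ (proj₁ (P∖e-transversal y∈P y≢e)))
        (≤-reflexive (trans (∣⁅x⁆∪p∣≡1+∣p∣ (proj₂ (P∖e-transversal y∈P y≢e))) 1+∣Z∣≡r))

      with-j-indep : ∀ {y} → y ∈ line s → y ≢ e → Indep M (⁅ y ⁆ ∪ ⁅ j ⁆ ∪ Z)
      with-j-indep {y} y∈ y≢e = independent
        (insert-transversal y≢e y∦ (transversal-⊆ (⁅x⁆∪p⊆q j∈S Z⊆S) S-transversal))
        (trans (∣⁅x⁆∪p∣≡1+∣p∣ (∉-⁅x⁆∪p (λ { refl → j∉line y∈ }) (line∖e∉Z y∈ y≢e)))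
               (cong suc (trans (∣⁅x⁆∪p∣≡1+∣p∣ j∉Z) 1+∣Z∣≡r)))
        where
        y∦ : ∀ {z} → z ∈ ⁅ j ⁆ ∪ Z → ¬ y ∥ z
        y∦ z∈ with ∈-⁅x⁆∪p⁻ z∈
        ... | inj₁ refl = ∈line⇒∦ y∈ y≢e j∈S j≢s
        ... | inj₂ z∈Z  = line∖e∦Z y∈ y≢e z∈Z

    pair-indep : ∀ {y y′} → y ∈ P → y′ ∈ P → y ≢ y′ → Indep M (⁅ y ⁆ ∪ ⁅ y′ ⁆ ∪ Z)
    pair-indep {y} {y′} y∈P y′∈P y≢y′ with y ≟ᶠ e | y′ ≟ᶠ e
    ... | yes refl | _        = with-e-indep y′∈P (y≢y′ ∘ sym)
    ... | no y≢e   | yes refl = indep-⊆ M ∪-swap-⊆ (with-e-indep y∈P y≢e)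
    ... | no y≢e   | no y′≢e  with ∈-⁅x⁆∪p⁻ y∈P | ∈-⁅x⁆∪p⁻ y′∈P
    ...   | inj₁ refl   | inj₁ refl    = contradiction refl y≢y′
    ...   | inj₁ refl   | inj₂ y′∈line = indep-⊆ M ∪-swap-⊆ (with-j-indep y′∈line y′≢e)
    ...   | inj₂ y∈line | inj₁ refl    = with-j-indep y∈line y≢e
    ...   | inj₂ y∈line | inj₂ y′∈line = indep-⊆ M ∪-swap-⊆
      (exchange x∈⁅x⁆∪p (∉-⁅x⁆∪p (y≢e ∘ sym) e∉Z) (with-e-indep y∈P y≢e)
                (collinear y∈line e∈line y′∈line y≢e y≢y′ (y′≢e ∘ sym)))

    spanned : ∀ {y} → y ∈ P → y ≢ e → y ≢ j → ¬ Indep M (⁅ y ⁆ ∪ ⁅ e ⁆ ∪ ⁅ j ⁆ ∪ Z)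
    spanned {y} y∈P y≢e y≢j i = <-irrefl refl (<-≤-trans (≤-reflexive (sym ∣X∣≡2+r)) (rank≤1+r i))
      where
      y∉Z : y ∉ Z
      y∉Z with ∈-⁅x⁆∪p⁻ y∈P
      ... | inj₁ y≡j    = contradiction y≡j y≢j
      ... | inj₂ y∈line = line∖e∉Z y∈line y≢e
      ∣X∣≡2+r : ∣ ⁅ y ⁆ ∪ ⁅ e ⁆ ∪ ⁅ j ⁆ ∪ Z ∣ ≡ suc (suc r)
      ∣X∣≡2+r = trans (∣⁅x⁆∪p∣≡1+∣p∣ (∉-⁅x⁆∪p y≢e (∉-⁅x⁆∪p y≢j y∉Z)))
                (cong suc (trans (∣⁅x⁆∪p∣≡1+∣p∣ (∉-⁅x⁆∪p (∈S⇒≢e j∈S ∘ sym) e∉Z))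
                (cong suc (trans (∣⁅x⁆∪p∣≡1+∣p∣ j∉Z) 1+∣Z∣≡r))))

    ∣line∣≤q : ∣ line s ∣ ≤ q
    ∣line∣≤q = ≤-pred (subst (_≤ suc q) (∣⁅x⁆∪p∣≡1+∣p∣ j∉line)
      (line-bound (p⊆⁅x⁆∪p e∈line) x∈⁅x⁆∪p (∈S⇒≢e j∈S ∘ sym) pair-indep spanned))

  long-line-bound : IndependentTransversals → ∀ {s} → s ∈ S → ∣ line s ∣ ≤ q
  long-line-bound independent {s} s∈S =
    let j , j∈S-s = ∣p∣>0⇒nonempty (S - s) (≤-pred (subst (1 <_) (sym 1+∣S-s∣≡n) 1<n))
        j∈S , j≢s = y∈p-x⁻ j∈S-s
        Z , Z⊆ , ∣Z∣≡r-1 = subset-of-size (S - s - j) (∸-monoˡ-≤ 1 (≤-pred (subst (suc r ≤_)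
                             (sym (trans (2+∣p-x-y∣≡∣p∣ s∈S j∈S (j≢s ∘ sym)) ∣S∣≡n)) r<n)))
    in LongLine.∣line∣≤q independent s∈S j∈S j≢s Z⊆ (trans (cong suc ∣Z∣≡r-1) (m+[n∸m]≡n 1≤r))
    where
    1≤r : 1 ≤ r
    1≤r = ≤-trans (s≤s z≤n) (<⇒≤ 2<r)
    1<n : 1 < n
    1<n = <-trans (s≤s (s≤s z≤n)) (<-trans 2<r r<n)
    1+∣S-s∣≡n : suc ∣ S - s ∣ ≡ n
    1+∣S-s∣≡n = trans (1+∣p-x∣≡∣p∣ s∈S) ∣S∣≡n

  open UniformMinor S-uniform

  rank-r-flat-allowed : ∀ {h} → suc r ≤ h → h ≤ n → Allowed q r n r h
  rank-r-flat-allowed {h} r<h h≤n with h ≟ n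
  ... | yes h≡n = inj₂ (inj₁ (refl , h≡n))
  ... | no h≢n  = inj₁ (small-flat-parameters 2≤r r<h h<n
                    (subst (λ k → suc k ≤ q + r) ∣S∣≡n (1+∣S∣≤q+r 2≤r (subst (r ≤_) (sym ∣S∣≡n) (<⇒≤ r<n))))
                    (1+r≤q (subst (suc (suc r) ≤_) (sym ∣S∣≡n) (≤-trans (s≤s r<h) h<n))))
    where
    2≤r : 2 ≤ r
    2≤r = <⇒≤ 2<r
    h<n : h < n
    h<n = ≤∧≢⇒< h≤n h≢n

  dependent-transversal-case : DependentTransversal → InducedUniform M (Allowed q r n)
  dependent-transversal-case T =
    let h , r<h , h≤n , U = dependent-transversal⇒flat T
    in induced U (rank-r-flat-allowed r<h h≤n)

  long-line? : Dec (∃ λ s → s ∈ S × 3 ≤ ∣ line s ∣)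
  long-line? = any? λ s → s ∈? S ×-dec 3 ≤? ∣ line s ∣

  long-line-case : ¬ DependentTransversal → ∀ {s} → s ∈ S → 3 ≤ ∣ line s ∣ → InducedUniform M (Allowed q r n)
  long-line-case none s∈S 3≤∣line∣ =
    induced (Line.line-flat s∈S) (line-allowed 3≤∣line∣ (long-line-bound (¬dependent⇒independent none) s∈S))

  short-lines-case : ¬ DependentTransversal → ¬ ∃ (λ s → s ∈ S × 3 ≤ ∣ line s ∣) →
                     InducedUniform M (Allowed q r n)
  short-lines-case none no-long-line =
    induced (short-lines⇒uniform (¬dependent⇒independent none) short) ground-allowed
    where
    short : ∀ {s} → s ∈ S → ∣ line s ∣ ≤ 2
    short s∈S = ≤-pred (≰⇒> λ 3≤∣line∣ → no-long-line (_ , s∈S , 3≤∣line∣))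

lemma3p7 : (q : ℕ) → IsPrimePower q → 2 < q →
    ∀ {m} (M : Matroid m) → Simple M → GFRepresentable q M →
    (e : Fin m) → (r n : ℕ) → 2 < r → r < n →
    SiIso (ContractIndep M e) (∁ ⁅ e ⁆) (UIndep r n) →
    Σ (Subset m) λ F → IsFlat M F ×
      (∃ λ r′ → ∃ λ n′ →
          ((∃ λ k → ∃ λ t → 3 ≤ k × k ≤ q × t ≤ q ∸ 3 × r′ ≡ 2 + t × n′ ≡ k + t)
           ⊎ (r′ ≡ r × n′ ≡ n)
           ⊎ (r′ ≡ r + 1 × n′ ≡ n + 1))
        × IsoRestr (Matroid.Indep M) F (UIndep r′ n′))
-- Only |𝔽| = q enters the proof.
lemma3p7 q _ _ M simple (𝔽 , isField , size , _ , v , rep) e r n 2<r r<n (S , S⊆∁e , _ , _ , cover , iso) =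
  case dependent-transversal? of λ where
    (yes T)   → dependent-transversal-case T
    (no none) → case long-line? of λ where
      (yes (_ , s∈S , 3≤∣line∣)) → long-line-case none s∈S 3≤∣line∣
      (no no-long-line)          → short-lines-case none no-long-line
  where open Cases 𝔽 isField size {M = M} {v = v} rep simple e 2<r r<n S⊆∁e cover iso
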